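{- Let $S$ be a set of primes and assume $\{a_n(q)\}_{n\ge1}\subseteq\mathbb{Z}[q]$ satisfies the $q$-Gauss congruences with respect to $S$. Let $n,m$ be positive integers with $n\in\mathbb{N}_S$. Then $a_{nm}(q)\equiv G_{g,n}(q)\pmod{[n]_q}$, and $G_{g,n}(q)$ is the remainder of $a_{nm}(q)$ upon division by $[n]_q$, where $g:D_n\to\mathbb{C}$, $g(d)=a_{dm}(1)$.
   Context: $[n]_q=\frac{q^n-1}{q-1}$; $\mu$ is the Möbius function; $\mathbb{N}_S$ is the set of positive integers all of whose prime factors lie in $S$. A sequence $\{a_n(q)\}\subseteq\mathbb{Z}[q]$ satisfies the $q$-Gauss congruences with respect to $S$ if for all $n\in\mathbb{N}_S$ and $m\ge1$, $\sum_{d\mid n}\mu(d)a_{nm/d}(q^d)$ is divisible by $[n]_q$ in $\mathbb{Z}[q]$. $D_n$ is the set of divisors of $n$ other than $n$; for $g:D_n\to\mathbb{C}$, $G_{g,n}(q)=\sum_{d\in D_n}\frac{[n]_q}{[n/d]_q}\cdot\frac{\sum_{e\mid d}\mu(d/e)g(e)}{d}\in\mathbb{C}[q]$. -}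

module Defs where

open import Data.Nat as ℕ using (ℕ; zero; suc; _≤_; _≟_)
open import Data.Nat.DivMod using (_/_)
open import Data.Nat.Divisibility using (_∣_; _∣?_)
open import Data.Nat.Primality using (Prime)
open import Data.Nat.Primality.Factorisation using (factorise; factors)
open import Data.Integer as ℤ using (ℤ; +_; -_)
open import Data.Rational as ℚ using (ℚ)
open import Data.List using (List; []; _∷_; map; filter; foldr; length; replicate; _++_; upTo)
import Data.List.Relation.Unary.Unique.DecPropositional as UniqueDec
open import Data.Product using (Σ; _×_)
open import Relation.Nullary using (¬_; does)
open import Relation.Nullary.Decidable using (_×-dec_; ¬?)
open import Relation.Binary.PropositionalEquality using (_≡_)

-- Möbius function: μ(n) = (-1)^(number of prime factors) if n is
-- squarefree (its prime factorisation has no repeated prime), else 0.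
-- (μ 0 is never used; set to 0.)

μ : ℕ → ℤ
μ zero = + 0
μ n@(suc _) with UniqueDec.unique? _≟_ (factors (factorise n))
... | Relation.Nullary.yes _ = (- + 1) ℤ.^ length (factors (factorise n))
... | Relation.Nullary.no _ = + 0

-- Polynomials over a (commutative) ring A as coefficient lists,
-- lowest degree first; trailing zeros allowed, equality is coefficientwise.

module PolyOps {A : Set} (0# 1# : A) (_+_ _*_ : A → A → A) (neg : A → A) where

  Poly : Set
  Poly = List A

  coeff : Poly → ℕ → A
  coeff []      _       = 0#
  coeff (a ∷ p) zero    = a
  coeff (a ∷ p) (suc k) = coeff p k

  _≈P_ : Poly → Poly → Set
  p ≈P r = ∀ k → coeff p k ≡ coeff r k

  _⊕_ : Poly → Poly → Poly
  []      ⊕ r       = r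
  (a ∷ p) ⊕ []      = a ∷ p
  (a ∷ p) ⊕ (b ∷ r) = (a + b) ∷ (p ⊕ r)

  scale : A → Poly → Poly
  scale c = map (c *_)

  _⊖_ : Poly → Poly → Poly
  p ⊖ r = p ⊕ map neg r

  _⊗_ : Poly → Poly → Poly
  []      ⊗ r = []
  (a ∷ p) ⊗ r = scale a r ⊕ (0# ∷ (p ⊗ r))

  sumP : List Poly → Poly
  sumP = foldr _⊕_ []

  -- substitution q ↦ q^d  (p(q) ↦ p(q^d)), used for d ≥ 1
  subst-pow : ℕ → Poly → Poly
  subst-pow d []          = []
  subst-pow d (a ∷ [])     = a ∷ []
  subst-pow d (a ∷ b ∷ p) = a ∷ (replicate (d ℕ.∸ 1) 0# ++ subst-pow d (b ∷ p))

  eval1 : Poly → A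
  eval1 = foldr _+_ 0#

  qint : ℕ → Poly
  qint n = replicate n 1#

  _∣P_ : Poly → Poly → Set
  r ∣P p = Σ Poly λ s → p ≈P (r ⊗ s)

  divSum : ℕ → (ℕ → ℕ → Poly) → Poly
  divSum n f = sumP (map (λ k → f (suc k) (n / suc k)) (filter (λ k → suc k ∣? n) (upTo n)))

  -- ∑_{d ∈ D_n} f d (n/d)   (positive divisors of n other than n)
  properDivSum : ℕ → (ℕ → ℕ → Poly) → Poly
  properDivSum n f = sumP (map (λ k → f (suc k) (n / suc k))
                            (filter (λ k → (suc k ∣? n) ×-dec ¬? (suc k ≟ n)) (upTo n)))

module ℤP = PolyOps (+ 0) (+ 1) ℤ._+_ ℤ._*_ ℤ.-_
module ℚP = PolyOps ℚ.0ℚ ℚ.1ℚ ℚ._+_ ℚ._*_ ℚ.-_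

divSumℤ : ℕ → (ℕ → ℕ → ℤ) → ℤ
divSumℤ n f = foldr ℤ._+_ (+ 0) (map (λ k → f (suc k) (n / suc k)) (filter (λ k → suc k ∣? n) (upTo n)))

-- z / d as a rational number (d ≥ 1 in all uses; 0 if d = 0)
divℚ : ℤ → ℕ → ℚ
divℚ z zero    = ℚ.0ℚ
divℚ z (suc k) = z ℚ./ suc k

toℚP : ℤP.Poly → ℚP.Poly
toℚP = map (λ z → z ℚ./ 1)

IsSetOfPrimes : (ℕ → Set) → Set
IsSetOfPrimes S = ∀ p → S p → Prime p

InNS : (ℕ → Set) → ℕ → Set
InNS S n = (1 ≤ n) × (∀ p → Prime p → p ∣ n → S p)

-- q-Gauss congruences w.r.t. S for a sequence (a n)_{n ≥ 1} (a 0 unused):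
-- for n ∈ ℕ_S, m ≥ 1:  [n]_q ∣ ∑_{d ∣ n} μ(d) a_{nm/d}(q^d)   in ℤ[q]
-- (nm/d is written (n/d)·m, equal since d ∣ n).
qGauss : (ℕ → Set) → (ℕ → ℤP.Poly) → Set
qGauss S a = ∀ n m → InNS S n → 1 ≤ m →
  ℤP.qint n ℤP.∣P ℤP.divSum n (λ d e → ℤP.scale (μ d) (ℤP.subst-pow d (a (e ℕ.* m))))

-- G_{g,n}(q) = ∑_{d ∈ D_n} ([n]_q/[n/d]_q) · (∑_{e ∣ d} μ(d/e) g(e)) / d,
-- with the polynomial quotient [n]_q/[n/d]_q written as [d]_{q^{n/d}}.
G : ℕ → (ℕ → ℤ) → ℚP.Poly
G n g = ℚP.properDivSum n (λ d nd →
          ℚP.scale (divℚ (divSumℤ d (λ e de → μ de ℤ.* g e)) d)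
                   (ℚP.subst-pow nd (ℚP.qint d)))

module Submission where

-- Fix n ∈ ℕ_S and m ≥ 1, and work in ℚ[q] with b_d = a_{dm}.
-- For every d ∣ n the q-Gauss hypothesis gives C_d = [d]_q · S_d, where
-- C_d(q) = ∑_{e ∣ d} μ(e) b_{d/e}(q^e).  Then:
--   (1) Möbius inversion:  ∑_{d ∣ n} C_d(q^{n/d}) = b_n(q).
--   (2) Evaluating C_d = [d]_q S_d at q = 1:  d · S_d(1) = ∑_{e ∣ d} μ(d/e) g(e).
--   (3) Writing S_d = S_d(1) + (q - 1) T_d and using
--       [d]_{q^k} (q^k - 1) = [dk]_q (q - 1), for dk = n we get
--       C_d(q^k) = S_d(1) [d]_{q^k} + [n]_q (q - 1) T_d(q^k).
--   (4) Summing (3) over d ∣ n and absorbing the term d = n, which is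
--       S_n(1)[n]_q, gives b_n = G_{g,n} + [n]_q W for an explicit W.
--   (5) For a proper divisor d the polynomial [d]_{q^{n/d}} has degree
--       n - n/d < n - 1, so G_{g,n} has no coefficients from degree n - 1 on.

open import Defs
open import Data.Nat using (ℕ; _≤_; _*_; _∸_)
open import Data.Integer using (ℤ)
open import Data.Rational using (0ℚ)
open import Data.Product using (_×_; _,_)
open import Relation.Binary.PropositionalEquality using (_≡_)

open import Algebra.Bundles using (CommutativeMonoid)

module Arithmetic where

  open import Data.Nat using (zero; suc; z≤n; s≤s)
  import Data.Nat.Properties as ℕP
  open import Data.Nat.Divisibility using (_∣_; ∣⇒≤)
  open import Data.Nat.DivMod using (_/_; m≥n⇒m/n>0; m*[n/m]≡n; m/n/o≡m/[n*o]; n/n≡1)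
  open import Relation.Nullary using (¬_)
  open import Relation.Binary.PropositionalEquality using (refl; sym; trans; cong)
  open import Data.Empty using (⊥-elim)

  -- Division that is total in the divisor (n /' 0 = 0), so that it can be
  -- applied to a variable; on successors it is _/_ definitionally.
  infixl 7 _/'_
  _/'_ : ℕ → ℕ → ℕ
  n /' zero = 0
  n /' suc k = n / suc k

  suc-∸1 : ∀ {n} → 1 ≤ n → suc (n ∸ 1) ≡ n
  suc-∸1 {suc n} _ = refl

  ∣⇒≤′ : ∀ {m n} → 1 ≤ n → m ∣ n → m ≤ n
  ∣⇒≤′ {n = suc n} _ m∣n = ∣⇒≤ m∣n

  quotient-pos : ∀ f n → 1 ≤ n → suc f ∣ n → 1 ≤ n / suc f
  quotient-pos f n n≥1 f∣n = m≥n⇒m/n>0 (∣⇒≤′ n≥1 f∣n)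

  quotient≥2 : ∀ f n → 1 ≤ n → suc f ∣ n → ¬ suc f ≡ n → 2 ≤ n / suc f
  quotient≥2 f n n≥1 f∣n f≢n with n / suc f | quotient-pos f n n≥1 f∣n | m*[n/m]≡n f∣n
  ... | suc zero    | _ | f*1≡n = ⊥-elim (f≢n (trans (sym (ℕP.*-identityʳ (suc f))) f*1≡n))
  ... | suc (suc _) | _ | _     = s≤s (s≤s z≤n)

  n/'n≡1 : ∀ n → 1 ≤ n → n /' n ≡ 1
  n/'n≡1 (suc n) _ = n/n≡1 (suc n)

  quotient-nested : ∀ e f n → suc e ∣ n /' suc f → suc e * (n /' (suc e * suc f)) ≡ n /' suc f
  quotient-nested e f n e∣n/f = trans
    (cong (suc e *_) (sym (trans (m/n/o≡m/[n*o] n (suc f) (suc e)) (cong (n /'_) (ℕP.*-comm (suc f) (suc e))))))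
    (m*[n/m]≡n e∣n/f)

module FiniteSums {c ℓ} (M : CommutativeMonoid c ℓ) where

  open import Data.Nat using (zero; suc; _<_; _<?_; _≟_; z≤n; s≤s)
  import Data.Nat.Properties as ℕP
  open import Data.List using (map; filter; foldr; applyUpTo)
  open import Relation.Nullary using (Dec; yes; no; ¬_)
  open import Relation.Nullary.Decidable using (_×-dec_; ¬?)
  open import Relation.Unary using (Pred; Decidable)
  import Relation.Binary.PropositionalEquality as Eq
  open import Data.Empty using (⊥-elim)
  open import Function using (_∘_)
  open import Data.Product using (proj₁; proj₂)

  open CommutativeMonoid M renaming (Carrier to C)
  open import Algebra.Properties.CommutativeSemigroup commutativeSemigroup using (interchange)
  open import Relation.Binary.Reasoning.Setoid setoid

  Σ< : ℕ → (ℕ → C) → C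
  Σ< zero f = ε
  Σ< (suc N) f = f 0 ∙ Σ< N (f ∘ suc)

  -- `guard d x` is x if the decided proposition holds and ε otherwise; the
  -- restricted sum ∑_{k < N, P k} f k is  Σ< N (λ k → guard (P? k) (f k)).
  guard : ∀ {p} {P : Set p} → Dec P → C → C
  guard (yes _) x = x
  guard (no _) x = ε

  guard-cong : ∀ {p} {P : Set p} (d : Dec P) {x y} → x ≈ y → guard d x ≈ guard d y
  guard-cong (yes _) e = e
  guard-cong (no _) e = refl

  guard-cong-if : ∀ {p} {P : Set p} (d : Dec P) {x y} → (P → x ≈ y) → guard d x ≈ guard d y
  guard-cong-if (yes p) e = e p
  guard-cong-if (no _) e = refl

  guard-yes : ∀ {p} {P : Set p} (d : Dec P) {x} → P → guard d x ≈ x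
  guard-yes (yes _) _ = refl
  guard-yes (no ¬p) p = ⊥-elim (¬p p)

  guard-no : ∀ {p} {P : Set p} (d : Dec P) {x} → ¬ P → guard d x ≈ ε
  guard-no (yes p) ¬p = ⊥-elim (¬p p)
  guard-no (no _) _ = refl

  guard-iff : ∀ {p q} {P : Set p} {Q : Set q} (d : Dec P) (e : Dec Q) {x y} →
              (P → Q) → (Q → P) → (P → x ≈ y) → guard d x ≈ guard e y
  guard-iff (yes p) (yes q) f g h = h p
  guard-iff (yes p) (no ¬q) f g h = ⊥-elim (¬q (f p))
  guard-iff (no ¬p) (yes q) f g h = ⊥-elim (¬p (g q))
  guard-iff (no _) (no _) f g h = refl

  guard²-iff : ∀ {a b c d} {A : Set a} {B : Set b} {X : Set c} {Y : Set d}
    (p : Dec A) (q : Dec B) (r : Dec X) (s : Dec Y) {x y} →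
    (A → B → X × Y) → (X → Y → A × B) → (A → B → x ≈ y) →
    guard p (guard q x) ≈ guard r (guard s y)
  guard²-iff (yes a) (yes b) (yes x) (yes y) f g h = h a b
  guard²-iff (yes a) (yes b) (yes x) (no ¬y) f g h = ⊥-elim (¬y (proj₂ (f a b)))
  guard²-iff (yes a) (yes b) (no ¬x) s f g h = ⊥-elim (¬x (proj₁ (f a b)))
  guard²-iff (yes a) (no ¬b) (yes x) (yes y) f g h = ⊥-elim (¬b (proj₂ (g x y)))
  guard²-iff (yes a) (no ¬b) (yes x) (no _) f g h = refl
  guard²-iff (yes a) (no ¬b) (no _) s f g h = refl
  guard²-iff (no ¬a) q (yes x) (yes y) f g h = ⊥-elim (¬a (proj₁ (g x y)))
  guard²-iff (no ¬a) q (yes x) (no _) f g h = refl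
  guard²-iff (no ¬a) q (no _) s f g h = refl

  guard-∙ : ∀ {p} {P : Set p} (d : Dec P) x y → guard d (x ∙ y) ≈ guard d x ∙ guard d y
  guard-∙ (yes _) x y = refl
  guard-∙ (no _) x y = sym (identityˡ ε)

  guard-× : ∀ {a b} {A : Set a} {B : Set b} (p : Dec A) (q : Dec B) x →
    guard p (guard q x) ≈ guard (p ×-dec q) x
  guard-× (yes _) (yes _) x = refl
  guard-× (yes _) (no _) x = refl
  guard-× (no _) q x = refl

  guard-split : ∀ {b} {B : Set b} (q : Dec B) x → x ≈ guard q x ∙ guard (¬? q) x
  guard-split (yes _) x = sym (identityʳ x)
  guard-split (no _) x = sym (identityˡ x)

  Σ<-cong : ∀ N {f g} → (∀ k → k < N → f k ≈ g k) → Σ< N f ≈ Σ< N g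
  Σ<-cong zero h = refl
  Σ<-cong (suc N) h = ∙-cong (h 0 (s≤s z≤n)) (Σ<-cong N (λ k k<N → h (suc k) (s≤s k<N)))

  Σ<-zero : ∀ N {f} → (∀ k → k < N → f k ≈ ε) → Σ< N f ≈ ε
  Σ<-zero zero h = refl
  Σ<-zero (suc N) h = trans (∙-cong (h 0 (s≤s z≤n)) (Σ<-zero N (λ k k<N → h (suc k) (s≤s k<N)))) (identityˡ ε)

  Σ<-∙ : ∀ N (f g : ℕ → C) → Σ< N (λ k → f k ∙ g k) ≈ Σ< N f ∙ Σ< N g
  Σ<-∙ zero f g = sym (identityˡ ε)
  Σ<-∙ (suc N) f g = trans (∙-congˡ (Σ<-∙ N (f ∘ suc) (g ∘ suc))) (interchange _ _ _ _)

  Σ<-swap : ∀ N K (f : ℕ → ℕ → C) → Σ< N (λ i → Σ< K (f i)) ≈ Σ< K (λ j → Σ< N (λ i → f i j))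
  Σ<-swap zero K f = sym (Σ<-zero K (λ _ _ → refl))
  Σ<-swap (suc N) K f = begin
    Σ< K (f 0) ∙ Σ< N (λ i → Σ< K (f (suc i))) ≈⟨ ∙-congˡ (Σ<-swap N K (f ∘ suc)) ⟩
    Σ< K (f 0) ∙ Σ< K (λ j → Σ< N (λ i → f (suc i) j)) ≈⟨ Σ<-∙ K (f 0) _ ⟨
    Σ< K (λ j → Σ< (suc N) (λ i → f i j)) ∎

  Σ<-guard : ∀ N {p} {P : Set p} (d : Dec P) (f : ℕ → C) → Σ< N (λ k → guard d (f k)) ≈ guard d (Σ< N f)
  Σ<-guard N (yes _) f = refl
  Σ<-guard N (no _) f = Σ<-zero N (λ _ _ → refl)

  Σ<-δ : ∀ N c (f : ℕ → C) → Σ< N (λ k → guard (k ≟ c) (f k)) ≈ guard (c <? N) (f c)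
  Σ<-δ zero c f = refl
  Σ<-δ (suc N) zero f = begin
    f 0 ∙ Σ< N (λ k → guard (suc k ≟ 0) (f (suc k)))
      ≈⟨ ∙-congˡ (Σ<-zero N (λ k _ → guard-no (suc k ≟ 0) {f (suc k)} (λ ()))) ⟩
    f 0 ∙ ε ≈⟨ identityʳ _ ⟩
    f 0 ≈⟨ guard-yes (0 <? suc N) (s≤s z≤n) ⟨
    guard (0 <? suc N) (f 0) ∎
  Σ<-δ (suc N) (suc c) f = begin
    guard (0 ≟ suc c) (f 0) ∙ Σ< N (λ k → guard (suc k ≟ suc c) (f (suc k)))
      ≈⟨ ∙-cong (guard-no (0 ≟ suc c) {f 0} (λ ()))
                (Σ<-cong N (λ k _ → guard-iff (suc k ≟ suc c) (k ≟ c) ℕP.suc-injective (Eq.cong suc) (λ _ → refl))) ⟩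
    ε ∙ Σ< N (λ k → guard (k ≟ c) (f (suc k))) ≈⟨ identityˡ _ ⟩
    Σ< N (λ k → guard (k ≟ c) (f (suc k))) ≈⟨ Σ<-δ N c (f ∘ suc) ⟩
    guard (c <? N) (f (suc c)) ≈⟨ guard-iff (c <? N) (suc c <? suc N) s≤s ℕP.≤-pred (λ _ → refl) ⟩
    guard (suc c <? suc N) (f (suc c)) ∎

  foldr-filter : ∀ {p} {P : Pred ℕ p} (P? : Decidable P) (h : ℕ → C) (g : ℕ → ℕ) N →
    foldr _∙_ ε (map h (filter P? (applyUpTo g N))) ≈ Σ< N (λ k → guard (P? (g k)) (h (g k)))
  foldr-filter P? h g zero = refl
  foldr-filter P? h g (suc N) with P? (g 0)
  ... | yes _ = ∙-congˡ (foldr-filter P? h (g ∘ suc) N)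
  ... | no _ = trans (foldr-filter P? h (g ∘ suc) N) (sym (identityˡ _))

  Σ<-reindex : ∀ N M {p q} {P : Pred ℕ p} {Q : Pred ℕ q} (P? : Decidable P) (Q? : Decidable Q)
    (φ ψ : ℕ → ℕ) (F : ℕ → C) →
    (∀ e → e < M → Q e → φ e < N × P (φ e) × ψ (φ e) ≡ e) →
    (∀ d → d < N → P d → ψ d < M × Q (ψ d) × φ (ψ d) ≡ d) →
    Σ< N (λ d → guard (P? d) (F d)) ≈ Σ< M (λ e → guard (Q? e) (F (φ e)))
  Σ<-reindex N M {P = P} {Q = Q} P? Q? φ ψ F φ-ok ψ-ok = begin
    Σ< N (λ d → guard (P? d) (F d))
      ≈⟨ Σ<-cong N (λ d d<N → spread d d<N) ⟨
    Σ< N (λ d → Σ< M (λ e → guard (e ≟ ψ d) (guard (P? d) (F d))))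
      ≈⟨ Σ<-swap N M _ ⟩
    Σ< M (λ e → Σ< N (λ d → guard (e ≟ ψ d) (guard (P? d) (F d))))
      ≈⟨ Σ<-cong M (λ e e<M → Σ<-cong N (λ d d<N → matched e d e<M d<N)) ⟩
    Σ< M (λ e → Σ< N (λ d → guard (d ≟ φ e) (guard (Q? e) (F (φ e)))))
      ≈⟨ Σ<-cong M (λ e e<M → collapse e e<M) ⟩
    Σ< M (λ e → guard (Q? e) (F (φ e))) ∎
    where
    spread : ∀ d → d < N → Σ< M (λ e → guard (e ≟ ψ d) (guard (P? d) (F d))) ≈ guard (P? d) (F d)
    spread d d<N = trans (Σ<-δ M (ψ d) _) (inRange (ψ d <? M) (P? d))
      where
      inRange : ∀ (u : Dec (ψ d < M)) (v : Dec (P d)) → guard u (guard v (F d)) ≈ guard v (F d)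
      inRange (yes _) v = refl
      inRange (no ψd≮M) (yes pd) = ⊥-elim (ψd≮M (proj₁ (ψ-ok d d<N pd)))
      inRange (no _) (no _) = refl
    collapse : ∀ e → e < M → Σ< N (λ d → guard (d ≟ φ e) (guard (Q? e) (F (φ e)))) ≈ guard (Q? e) (F (φ e))
    collapse e e<M = trans (Σ<-δ N (φ e) _) (inRange (φ e <? N) (Q? e))
      where
      inRange : ∀ (u : Dec (φ e < N)) (v : Dec (Q e)) → guard u (guard v (F (φ e))) ≈ guard v (F (φ e))
      inRange (yes _) v = refl
      inRange (no φe≮N) (yes qe) = ⊥-elim (φe≮N (proj₁ (φ-ok e e<M qe)))
      inRange (no _) (no _) = refl
    matched : ∀ e d → e < M → d < N →
      guard (e ≟ ψ d) (guard (P? d) (F d)) ≈ guard (d ≟ φ e) (guard (Q? e) (F (φ e)))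
    matched e d e<M d<N = guard²-iff (e ≟ ψ d) (P? d) (d ≟ φ e) (Q? e)
      (λ { Eq.refl pd → let (_ , qψd , φψd≡d) = ψ-ok d d<N pd in Eq.sym φψd≡d , qψd })
      (λ { Eq.refl qe → let (_ , pφe , ψφe≡e) = φ-ok e e<M qe in Eq.sym ψφe≡e , pφe })
      (λ { Eq.refl pd → reflexive (Eq.cong F (Eq.sym (proj₂ (proj₂ (ψ-ok d d<N pd))))) })

module SumHomomorphism {c ℓ c' ℓ'} (M : CommutativeMonoid c ℓ) (M' : CommutativeMonoid c' ℓ')
  (φ : CommutativeMonoid.Carrier M → CommutativeMonoid.Carrier M')
  (φ-ε : CommutativeMonoid._≈_ M' (φ (CommutativeMonoid.ε M)) (CommutativeMonoid.ε M'))
  (φ-∙ : ∀ x y → CommutativeMonoid._≈_ M' (φ (CommutativeMonoid._∙_ M x y))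
                                         (CommutativeMonoid._∙_ M' (φ x) (φ y))) where

  open import Data.Nat using (zero; suc)
  open import Relation.Nullary using (Dec; yes; no)
  open import Relation.Unary using (Pred; Decidable)
  open import Function using (_∘_)

  open CommutativeMonoid M using (ε)
  open FiniteSums M
  private module M' = CommutativeMonoid M'
  private module Σ' = FiniteSums M'

  Σ<-hom : ∀ N f → φ (Σ< N f) M'.≈ Σ'.Σ< N (φ ∘ f)
  Σ<-hom zero f = φ-ε
  Σ<-hom (suc N) f = M'.trans (φ-∙ _ _) (M'.∙-congˡ (Σ<-hom N (f ∘ suc)))

  guard-hom : ∀ {p} {P : Set p} (d : Dec P) x → φ (guard d x) M'.≈ Σ'.guard d (φ x)
  guard-hom (yes _) x = M'.refl
  guard-hom (no _) x = φ-ε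

  Σ<-guard-hom : ∀ N {p} {P : Pred ℕ p} (P? : Decidable P) (f : ℕ → _) →
    φ (Σ< N (λ k → guard (P? k) (f k))) M'.≈ Σ'.Σ< N (λ k → Σ'.guard (P? k) (φ (f k)))
  Σ<-guard-hom N P? f = M'.trans (Σ<-hom N _) (Σ'.Σ<-cong N (λ k _ → guard-hom (P? k) (f k)))

module DivisorSums {c ℓ} (M : CommutativeMonoid c ℓ) where

  open import Data.Nat using (suc; _<_; _≟_; _<?_; z≤n; s≤s)
  import Data.Nat.Properties as ℕP
  open import Data.Nat.Divisibility
  open import Data.Nat.DivMod using (_/_; m*n/n≡m; m/n*n≡m; m*[n/m]≡n; m/n≤m)
  open import Relation.Nullary using (Dec)
  open import Relation.Nullary.Decidable using (_×-dec_; ¬?)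
  open import Relation.Unary using (Pred; Decidable)
  import Relation.Binary.PropositionalEquality as Eq
  open import Function using (id; _∘_)

  open Arithmetic
  open CommutativeMonoid M renaming (Carrier to C)
  open FiniteSums M public
  open import Relation.Binary.Reasoning.Setoid setoid

  DS : ℕ → (ℕ → C) → C
  DS n F = Σ< n (λ j → guard (suc j ∣? n) (F (suc j)))

  PDS : ℕ → (ℕ → C) → C
  PDS n F = Σ< n (λ j → guard ((suc j ∣? n) ×-dec ¬? (suc j ≟ n)) (F (suc j)))

  Σ<-extend : ∀ d n {p} {P : Pred ℕ p} (P? : Decidable P) (G : ℕ → C) → d ≤ n → (∀ i → P i → i < d) →
    Σ< d (λ i → guard (P? i) (G i)) ≈ Σ< n (λ i → guard (P? i) (G i))
  Σ<-extend d n P? G d≤n bound = Σ<-reindex d n P? P? id id G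
    (λ e _ pe → bound e pe , pe , Eq.refl) (λ e e<d pe → ℕP.<-≤-trans e<d d≤n , pe , Eq.refl)

  DS-as-Σ< : ∀ d n (G : ℕ → C) → 1 ≤ d → d ≤ n → DS d G ≈ Σ< n (λ i → guard (suc i ∣? d) (G (suc i)))
  DS-as-Σ< d n G d≥1 d≤n = Σ<-extend d n (λ i → suc i ∣? d) (G ∘ suc) d≤n (λ i si∣d → ∣⇒≤′ d≥1 si∣d)

  Σ<-guard-swap : ∀ n {p} {P : Pred ℕ p} (P? : Decidable P) (H : ℕ → ℕ → C) →
    Σ< n (λ j → guard (P? j) (Σ< n (H j))) ≈ Σ< n (λ i → Σ< n (λ j → guard (P? j) (H j i)))
  Σ<-guard-swap n P? H = trans (Σ<-cong n (λ j _ → sym (Σ<-guard n (P? j) (H j)))) (Σ<-swap n n _)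

  DS-split-top : ∀ n (F : ℕ → C) → 1 ≤ n → DS n F ≈ PDS n F ∙ F n
  DS-split-top n F n≥1 = begin
    DS n F ≈⟨ Σ<-cong n (λ j _ → splitTerm j) ⟩
    Σ< n (λ j → guard (isTop j) (F (suc j)) ∙ guard (isProper j) (F (suc j))) ≈⟨ Σ<-∙ n _ _ ⟩
    Σ< n (λ j → guard (isTop j) (F (suc j))) ∙ PDS n F ≈⟨ comm _ _ ⟩
    PDS n F ∙ Σ< n (λ j → guard (isTop j) (F (suc j))) ≈⟨ ∙-congˡ topTerm ⟩
    PDS n F ∙ F n ∎
    where
    isTop isProper : ∀ j → Dec _
    isTop j = (suc j ∣? n) ×-dec (suc j ≟ n)
    isProper j = (suc j ∣? n) ×-dec ¬? (suc j ≟ n)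
    splitTerm : ∀ j → guard (suc j ∣? n) (F (suc j)) ≈ guard (isTop j) (F (suc j)) ∙ guard (isProper j) (F (suc j))
    splitTerm j = trans (guard-cong (suc j ∣? n) (guard-split (suc j ≟ n) (F (suc j))))
      (trans (guard-∙ (suc j ∣? n) _ _) (∙-cong (guard-× (suc j ∣? n) (suc j ≟ n) _) (guard-× (suc j ∣? n) (¬? (suc j ≟ n)) _)))
    is-n : ∀ {j} → j ≡ n ∸ 1 → suc j ≡ n
    is-n e = Eq.trans (Eq.cong suc e) (suc-∸1 n≥1)
    topTerm : Σ< n (λ j → guard (isTop j) (F (suc j))) ≈ F n
    topTerm = begin
      Σ< n (λ j → guard (isTop j) (F (suc j)))
        ≈⟨ Σ<-cong n (λ j _ → guard-iff (isTop j) (j ≟ n ∸ 1) (λ (_ , e) → Eq.cong (_∸ 1) e)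
                                 (λ e → Eq.subst (_∣ n) (Eq.sym (is-n e)) ∣-refl , is-n e) (λ _ → refl)) ⟩
      Σ< n (λ j → guard (j ≟ n ∸ 1) (F (suc j))) ≈⟨ Σ<-δ n (n ∸ 1) (F ∘ suc) ⟩
      guard (n ∸ 1 <? n) (F (suc (n ∸ 1))) ≈⟨ guard-yes (n ∸ 1 <? n) (ℕP.≤-reflexive (suc-∸1 n≥1)) ⟩
      F (suc (n ∸ 1)) ≈⟨ reflexive (Eq.cong F (suc-∸1 n≥1)) ⟩
      F n ∎

  complement-involutive : ∀ i d → 1 ≤ d → suc i ∣ d → d /' suc (d / suc i ∸ 1) ≡ suc i
  complement-involutive i d d≥1 si∣d with d / suc i | quotient-pos i d d≥1 si∣d | m/n*n≡m si∣d
  ... | suc t | _ | t*si≡d =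
    Eq.trans (Eq.cong (_/ suc t) (Eq.sym (Eq.trans (ℕP.*-comm (suc i) (suc t)) t*si≡d))) (m*n/n≡m (suc i) (suc t))

  -- ∑_{e ∣ d} Ψ e (d/e) = ∑_{e ∣ d} Ψ (d/e) e, by the involution e ↦ d/e.
  DS-complement : ∀ d (Ψ : ℕ → ℕ → C) → DS d (λ e → Ψ e (d /' e)) ≈ DS d (λ e → Ψ (d /' e) e)
  DS-complement d Ψ = trans (Σ<-reindex d d divides? divides? φ φ (λ i → Ψ (suc i) (d /' suc i)) φ-ok φ-ok)
    (Σ<-cong d (λ i i<d → guard-cong-if (suc i ∣? d) (λ si∣d → reflexive (swapped i i<d si∣d))))
    where
    divides? = λ i → suc i ∣? d
    φ : ℕ → ℕ
    φ i = d / suc i ∸ 1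
    φ-ok : ∀ i → i < d → suc i ∣ d → φ i < d × suc (φ i) ∣ d × φ (φ i) ≡ i
    φ-ok i i<d si∣d = Eq.subst (_≤ d) (Eq.sym sφi) (m/n≤m d (suc i)) ,
      Eq.subst (_∣ d) (Eq.sym sφi) (m/n∣m si∣d) ,
      Eq.cong (_∸ 1) (complement-involutive i d d≥1 si∣d)
      where
      d≥1 = ℕP.<-≤-trans (s≤s z≤n) i<d
      sφi = suc-∸1 (quotient-pos i d d≥1 si∣d)
    swapped : ∀ i → i < d → suc i ∣ d → Ψ (suc (φ i)) (d /' suc (φ i)) ≡ Ψ (d /' suc i) (suc i)
    swapped i i<d si∣d = Eq.cong₂ Ψ (suc-∸1 (quotient-pos i d d≥1 si∣d)) (complement-involutive i d d≥1 si∣d)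
      where d≥1 = ℕP.<-≤-trans (s≤s z≤n) i<d

  -- For fixed e ∣ n: the multiples d of e dividing n correspond to the
  -- divisors l of n/e, via d = l e.
  multiples-reindex : ∀ n i (Ψ : ℕ → ℕ → C) →
    Σ< n (λ j → guard ((suc j ∣? n) ×-dec (suc i ∣? suc j)) (Ψ (suc j) (suc i)))
      ≈ Σ< n (λ l → guard ((suc i ∣? n) ×-dec (suc l ∣? n / suc i)) (Ψ (suc l * suc i) (suc i)))
  multiples-reindex n i Ψ = trans
    (Σ<-reindex n n (λ j → (suc j ∣? n) ×-dec (suc i ∣? suc j)) (λ l → (suc i ∣? n) ×-dec (suc l ∣? n / suc i))
       φ ψ (λ j → Ψ (suc j) (suc i)) φ-ok ψ-ok)
    (Σ<-cong n (λ l _ → guard-cong ((suc i ∣? n) ×-dec (suc l ∣? n / suc i))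
       (reflexive (Eq.cong (λ x → Ψ x (suc i)) (suc-∸1 (s≤s z≤n))))))
    where
    si = suc i
    φ ψ : ℕ → ℕ
    φ l = suc l * si ∸ 1
    ψ j = suc j / si ∸ 1
    φ-ok : ∀ l → l < n → si ∣ n × suc l ∣ n / si → φ l < n × (suc (φ l) ∣ n × si ∣ suc (φ l)) × ψ (φ l) ≡ l
    φ-ok l l<n (si∣n , l∣n/i) = Eq.subst (_≤ n) (Eq.sym sφl) (∣⇒≤′ (ℕP.<-≤-trans (s≤s z≤n) l<n) li∣n) ,
      (Eq.subst (_∣ n) (Eq.sym sφl) li∣n , Eq.subst (si ∣_) (Eq.sym sφl) (n∣m*n (suc l))) ,
      Eq.cong (_∸ 1) (Eq.trans (Eq.cong (_/ si) sφl) (m*n/n≡m (suc l) si))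
      where
      li∣n = m∣n/o⇒m*o∣n si∣n l∣n/i
      sφl = suc-∸1 {suc l * si} (s≤s z≤n)
    ψ-ok : ∀ j → j < n → suc j ∣ n × si ∣ suc j → ψ j < n × (si ∣ n × suc (ψ j) ∣ n / si) × φ (ψ j) ≡ j
    ψ-ok j j<n (j∣n , si∣j) = Eq.subst (_≤ n) (Eq.sym sψj) (ℕP.≤-trans (m/n≤m (suc j) si) j<n) ,
        (∣-trans si∣j j∣n , Eq.subst (_∣ n / si) (Eq.sym sψj) (m*n∣o⇒n∣o/m si _ (Eq.subst (_∣ n) (Eq.sym (m*[n/m]≡n si∣j)) j∣n))) ,
        Eq.trans (Eq.cong (λ x → x * si ∸ 1) sψj) (Eq.cong (_∸ 1) (m/n*n≡m si∣j))
      where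
      sψj = suc-∸1 (quotient-pos i (suc j) (s≤s z≤n) si∣j)

  DS-nested : ∀ n (Ψ : ℕ → ℕ → C) →
    DS n (λ d → DS d (Ψ d)) ≈ DS n (λ f → DS (n /' f) (λ e → Ψ (e * f) e))
  DS-nested n Ψ = begin
    DS n (λ d → DS d (Ψ d))
      ≈⟨ Σ<-cong n (λ j j<n → guard-cong-if (suc j ∣? n) (λ sj∣n →
           DS-as-Σ< (suc j) n (Ψ (suc j)) (s≤s z≤n) (∣⇒≤′ (n≥1 j<n) sj∣n))) ⟩
    Σ< n (λ j → guard (suc j ∣? n) (Σ< n (λ i → guard (suc i ∣? suc j) (Ψ (suc j) (suc i)))))
      ≈⟨ Σ<-guard-swap n (λ j → suc j ∣? n) _ ⟩
    Σ< n (λ i → Σ< n (λ j → guard (suc j ∣? n) (guard (suc i ∣? suc j) (Ψ (suc j) (suc i)))))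
      ≈⟨ Σ<-cong n (λ i _ → trans (Σ<-cong n (λ j _ → guard-× (suc j ∣? n) (suc i ∣? suc j) _)) (multiples-reindex n i Ψ)) ⟩
    Σ< n (λ i → Σ< n (λ l → guard ((suc i ∣? n) ×-dec (suc l ∣? n / suc i)) (Ψ (suc l * suc i) (suc i))))
      ≈⟨ Σ<-cong n (λ i _ → Σ<-cong n (λ l _ → guard-iff ((suc i ∣? n) ×-dec (suc l ∣? n / suc i))
                                                       ((suc l ∣? n) ×-dec (suc i ∣? n / suc l))
           (λ (i∣n , l∣n/i) → let li∣n = m∣n/o⇒m*o∣n i∣n l∣n/i in m*n∣⇒m∣ (suc l) (suc i) li∣n , m*n∣o⇒n∣o/m (suc l) (suc i) li∣n)
           (λ (l∣n , i∣n/l) → let il∣n = m∣n/o⇒m*o∣n l∣n i∣n/l in m*n∣⇒m∣ (suc i) (suc l) il∣n , m*n∣o⇒n∣o/m (suc i) (suc l) il∣n)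
           (λ _ → reflexive (Eq.cong (λ x → Ψ x (suc i)) (ℕP.*-comm (suc l) (suc i)))))) ⟩
    Σ< n (λ i → Σ< n (λ l → guard ((suc l ∣? n) ×-dec (suc i ∣? n / suc l)) (Ψ (suc i * suc l) (suc i))))
      ≈⟨ Σ<-cong n (λ i _ → Σ<-cong n (λ l _ → guard-× (suc l ∣? n) (suc i ∣? n / suc l) _)) ⟨
    Σ< n (λ i → Σ< n (λ l → guard (suc l ∣? n) (guard (suc i ∣? n / suc l) (Ψ (suc i * suc l) (suc i)))))
      ≈⟨ Σ<-guard-swap n (λ l → suc l ∣? n) _ ⟨
    Σ< n (λ l → guard (suc l ∣? n) (Σ< n (λ i → guard (suc i ∣? n / suc l) (Ψ (suc i * suc l) (suc i)))))
      ≈⟨ Σ<-cong n (λ l l<n → guard-cong-if (suc l ∣? n) (λ sl∣n →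
           DS-as-Σ< (n / suc l) n (λ e → Ψ (e * suc l) e) (quotient-pos l n (n≥1 l<n) sl∣n) (m/n≤m n (suc l)))) ⟨
    DS n (λ f → DS (n /' f) (λ e → Ψ (e * f) e)) ∎
    where
    n≥1 : ∀ {j} → j < n → 1 ≤ n
    n≥1 j<n = ℕP.<-≤-trans (s≤s z≤n) j<n

module MöbiusValues where

  open import Data.Nat using (zero; suc; _≟_)
  open import Relation.Binary.PropositionalEquality as Eq using (refl; sym; trans; cong; subst; module ≡-Reasoning)
  import Data.Nat.Properties as ℕP
  open import Data.Nat.Divisibility using (_∣_; divides)
  open import Data.Nat.Primality using (Prime; ¬prime[0])
  open import Data.Nat.Primality.Factorisation
  open import Data.Nat.ListAction using (product)
  open import Data.Nat.ListAction.Properties using (∈⇒∣product)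
  open import Data.Integer as ℤ using (+_; -_)
  import Data.Integer.Properties as ℤProp
  open import Data.List using (List; _∷_; length)
  open import Data.List.Relation.Unary.All using (All; _∷_)
  open import Data.List.Relation.Unary.All.Properties.Core using (¬Any⇒All¬)
  open import Data.List.Relation.Unary.Unique.DecPropositional _≟_ using (Unique; unique?; _∷_)
  open import Data.List.Relation.Binary.Permutation.Propositional using (_↭_; ↭-sym; ↭⇒↭ₛ)
  open import Data.List.Relation.Binary.Permutation.Propositional.Properties using (↭-length)
  open import Data.List.Relation.Binary.Permutation.Setoid.Properties (Eq.setoid ℕ) using (Unique-resp-↭)
  open import Data.List.Membership.Propositional using (_∈_)
  open import Relation.Nullary using (Dec; yes; no; ¬_)
  open import Data.Empty using (⊥-elim)

  signOfDec : ∀ L → Dec (Unique L) → ℤ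
  signOfDec L (yes _) = (- + 1) ℤ.^ length L
  signOfDec L (no _) = + 0

  signOf : List ℕ → ℤ
  signOf L = signOfDec L (unique? L)

  μ≡signOf-factors : ∀ n → μ (suc n) ≡ signOf (factors (factorise (suc n)))
  μ≡signOf-factors n with unique? (factors (factorise (suc n)))
  ... | yes _ = refl
  ... | no _ = refl

  signOf-↭ : ∀ {xs ys} → xs ↭ ys → signOf xs ≡ signOf ys
  signOf-↭ {xs} {ys} xs↭ys = go (unique? xs) (unique? ys)
    where
    go : ∀ u v → signOfDec xs u ≡ signOfDec ys v
    go (yes _) (yes _) = cong ((- + 1) ℤ.^_) (↭-length xs↭ys)
    go (yes u) (no ¬u) = ⊥-elim (¬u (Unique-resp-↭ (↭⇒↭ₛ xs↭ys) u))
    go (no ¬u) (yes u) = ⊥-elim (¬u (Unique-resp-↭ (↭⇒↭ₛ (↭-sym xs↭ys)) u))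
    go (no _) (no _) = refl

  -- By uniqueness of prime factorisation, μ may be computed from any list of
  -- primes with the right product.
  μ-from-primes : ∀ n L → All Prime L → product L ≡ suc n → μ (suc n) ≡ signOf L
  μ-from-primes n L L-prime prod≡n = trans (μ≡signOf-factors n) (signOf-↭ (factorisationUnique (factorise (suc n))
    (record { factors = L ; isFactorisation = sym prod≡n ; factorsPrime = L-prime })))

  signOf-new-prime : ∀ p L → ¬ p ∈ L → signOf (p ∷ L) ≡ - signOf L
  signOf-new-prime p L p∉L = go (unique? (p ∷ L)) (unique? L)
    where
    go : ∀ u v → signOfDec (p ∷ L) u ≡ - signOfDec L v
    go (yes _) (yes _) = ℤProp.-1*i≡-i _
    go (yes (_ ∷ u)) (no ¬u) = ⊥-elim (¬u u)
    go (no ¬u) (yes u) = ⊥-elim (¬u (¬Any⇒All¬ L p∉L ∷ u))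
    go (no _) (no _) = refl

  μ-prime-times : ∀ p e → Prime p → ¬ p ∣ suc e → μ (p * suc e) ≡ - μ (suc e)
  μ-prime-times zero e p-prime _ = ⊥-elim (¬prime[0] p-prime)
  μ-prime-times p@(suc _) e p-prime p∤e = begin
    μ (p * suc e) ≡⟨ μ-from-primes _ (p ∷ F) (p-prime ∷ PrimeFactorisation.factorsPrime fe)
                       (cong (p *_) (sym (PrimeFactorisation.isFactorisation fe))) ⟩
    signOf (p ∷ F) ≡⟨ signOf-new-prime p F (λ p∈F → p∤e (subst (p ∣_) (sym (PrimeFactorisation.isFactorisation fe)) (∈⇒∣product p∈F))) ⟩
    - signOf F     ≡⟨ cong -_ (sym (μ≡signOf-factors e)) ⟩
    - μ (suc e)    ∎
    where
    open ≡-Reasoning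
    fe = factorise (suc e)
    F = factors fe

  μ-square-divisor : ∀ p e → Prime p → p * p ∣ suc e → μ (suc e) ≡ + 0
  μ-square-divisor p e p-prime (divides zero e≡0) = ⊥-elim (ℕP.0≢1+n (sym e≡0))
  μ-square-divisor p e p-prime (divides (suc r) e≡rpp) =
    trans (μ-from-primes e (p ∷ p ∷ R) (p-prime ∷ p-prime ∷ PrimeFactorisation.factorsPrime fr) prod≡e) repeated
    where
    open ≡-Reasoning
    fr = factorise (suc r)
    R = factors fr
    prod≡e : p * (p * product R) ≡ suc e
    prod≡e = begin
      p * (p * product R) ≡⟨ cong (λ x → p * (p * x)) (sym (PrimeFactorisation.isFactorisation fr)) ⟩
      p * (p * suc r)     ≡⟨ ℕP.*-assoc p p (suc r) ⟨
      p * p * suc r       ≡⟨ ℕP.*-comm (p * p) (suc r) ⟩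
      suc r * (p * p)     ≡⟨ e≡rpp ⟨
      suc e               ∎
    repeated : signOf (p ∷ p ∷ R) ≡ + 0
    repeated with unique? (p ∷ p ∷ R)
    ... | yes ((p≢p ∷ _) ∷ _) = ⊥-elim (p≢p refl)
    ... | no _ = refl

module MöbiusSum where

  open import Data.Nat using (suc; _<_; z≤n; s≤s)
  import Data.Nat.Properties as ℕP
  open import Data.Nat.Divisibility
  open import Data.Nat.DivMod using (_/_; m*n/n≡m; m*[n/m]≡n; m≥n⇒m/n>0)
  open import Data.Nat.Primality using (Prime; prime⇒nonZero; prime⇒irreducible)
  open import Data.Nat.Primality.Factorisation using (factorise; factors; PrimeFactorisation)
  open import Data.Nat.ListAction using (product)
  open import Data.Nat.ListAction.Properties using (∈⇒∣product)
  open import Data.Nat.Coprimality using (Coprime; coprime-divisor)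
  open import Data.Integer as ℤ using (+_; -_)
  import Data.Integer.Properties as ℤProp
  open import Data.List using (List; []; _∷_)
  open import Data.List.Relation.Unary.All using (All; _∷_)
  open import Data.List.Relation.Unary.Any using (here)
  open import Relation.Nullary using (Dec; yes; no; ¬_)
  open import Relation.Nullary.Decidable using (_×-dec_; ¬?)
  open import Relation.Binary.PropositionalEquality
  open import Data.Empty using (⊥-elim)
  open import Data.Sum using (inj₁; inj₂)
  open import Data.Product using (Σ-syntax)

  open Arithmetic
  open MöbiusValues
  open DivisorSums ℤProp.+-0-commutativeMonoid
  private module Negation = SumHomomorphism ℤProp.+-0-commutativeMonoid ℤProp.+-0-commutativeMonoid -_ refl ℤProp.neg-distrib-+

  μ-sum : ℕ → ℤ
  μ-sum k = DS k μ

  coprime-to-prime : ∀ {p m} → Prime p → ¬ p ∣ m → Coprime m p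
  coprime-to-prime p-prime p∤m (d∣m , d∣p) with prime⇒irreducible p-prime d∣p
  ... | inj₁ d≡1 = d≡1
  ... | inj₂ refl = ⊥-elim (p∤m d∣m)

  -- Splitting the divisors of K = p k according to whether p divides them:
  -- the divisors prime to p are those of k prime to p (sum T), and the
  -- multiples of p are p e with e ∣ k, contributing μ(p e) = -μ(e) if p ∤ e
  -- and 0 otherwise (sum -T).
  module AtPrimeMultiple (p k : ℕ) (p-prime : Prime p) (k≥1 : 1 ≤ k) where
    instance _ = prime⇒nonZero p-prime

    K = p * k

    k∣K : k ∣ K
    k∣K = divides p refl

    divisor≤k : ∀ {j} → suc j ∣ k → suc j ≤ k
    divisor≤k = ∣⇒≤′ k≥1

    T : ℤ
    T = Σ< k (λ i → guard (suc i ∣? k) (guard (¬? (p ∣? suc i)) (μ (suc i))))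

    primeToP-part : Σ< K (λ j → guard (suc j ∣? K) (guard (¬? (p ∣? suc j)) (μ (suc j)))) ≡ T
    primeToP-part = begin
      Σ< K (λ j → guard (suc j ∣? K) (guard (¬? (p ∣? suc j)) (μ (suc j))))
        ≡⟨ Σ<-cong K (λ j _ → guard-× (suc j ∣? K) (¬? (p ∣? suc j)) (μ (suc j))) ⟩
      Σ< K (λ j → guard ((suc j ∣? K) ×-dec ¬? (p ∣? suc j)) (μ (suc j)))
        ≡⟨ Σ<-reindex K k (λ j → (suc j ∣? K) ×-dec ¬? (p ∣? suc j)) (λ i → (suc i ∣? k) ×-dec ¬? (p ∣? suc i))
             (λ i → i) (λ j → j) (λ j → μ (suc j)) into-K into-k ⟩
      Σ< k (λ i → guard ((suc i ∣? k) ×-dec ¬? (p ∣? suc i)) (μ (suc i)))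
        ≡⟨ Σ<-cong k (λ i _ → guard-× (suc i ∣? k) (¬? (p ∣? suc i)) (μ (suc i))) ⟨
      T ∎
      where
      open ≡-Reasoning
      into-K : ∀ i → i < k → suc i ∣ k × ¬ p ∣ suc i → i < K × (suc i ∣ K × ¬ p ∣ suc i) × i ≡ i
      into-K i i<k (i∣k , p∤i) = ℕP.<-≤-trans i<k (ℕP.m≤n*m k p) , (∣-trans i∣k k∣K , p∤i) , refl
      into-k : ∀ j → j < K → suc j ∣ K × ¬ p ∣ suc j → j < k × (suc j ∣ k × ¬ p ∣ suc j) × j ≡ j
      into-k j j<K (j∣K , p∤j) = divisor≤k j∣k , (j∣k , p∤j) , refl
        where
        j∣k : suc j ∣ k
        j∣k = coprime-divisor (coprime-to-prime p-prime p∤j) j∣K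

    p*e≥1 : ∀ i → 1 ≤ p * suc i
    p*e≥1 i = ℕP.≤-trans (s≤s z≤n) (ℕP.m≤n*m (suc i) p)

    μ-p-times : ∀ i → μ (suc (p * suc i ∸ 1)) ≡ - guard (¬? (p ∣? suc i)) (μ (suc i))
    μ-p-times i = trans (cong μ (suc-∸1 (p*e≥1 i))) (byCase (p ∣? suc i))
      where
      byCase : (d : Dec (p ∣ suc i)) → μ (p * suc i) ≡ - guard (¬? d) (μ (suc i))
      byCase (yes p∣i) with p * suc i | p*e≥1 i | *-monoʳ-∣ p p∣i
      ... | suc e | _ | pp∣pe = μ-square-divisor p e p-prime pp∣pe
      byCase (no p∤i) = μ-prime-times p i p-prime p∤i

    multipleOfP-part : Σ< K (λ j → guard (suc j ∣? K) (guard (p ∣? suc j) (μ (suc j)))) ≡ - T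
    multipleOfP-part = begin
      Σ< K (λ j → guard (suc j ∣? K) (guard (p ∣? suc j) (μ (suc j))))
        ≡⟨ Σ<-cong K (λ j _ → guard-× (suc j ∣? K) (p ∣? suc j) (μ (suc j))) ⟩
      Σ< K (λ j → guard ((suc j ∣? K) ×-dec (p ∣? suc j)) (μ (suc j)))
        ≡⟨ Σ<-reindex K k (λ j → (suc j ∣? K) ×-dec (p ∣? suc j)) (λ i → suc i ∣? k)
             times-p div-p (λ j → μ (suc j)) times-p-ok div-p-ok ⟩
      Σ< k (λ i → guard (suc i ∣? k) (μ (suc (times-p i))))
        ≡⟨ Σ<-cong k (λ i _ → guard-cong (suc i ∣? k) (μ-p-times i)) ⟩
      Σ< k (λ i → guard (suc i ∣? k) (- guard (¬? (p ∣? suc i)) (μ (suc i))))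
        ≡⟨ Σ<-cong k (λ i _ → Negation.guard-hom (suc i ∣? k) _) ⟨
      Σ< k (λ i → - guard (suc i ∣? k) (guard (¬? (p ∣? suc i)) (μ (suc i))))
        ≡⟨ Negation.Σ<-hom k _ ⟨
      - T ∎
      where
      open ≡-Reasoning
      -- index j of the divisor p·(i+1), and its inverse
      times-p div-p : ℕ → ℕ
      times-p i = p * suc i ∸ 1
      div-p j = suc j / p ∸ 1
      times-p-ok : ∀ i → i < k → suc i ∣ k → times-p i < K × (suc (times-p i) ∣ K × p ∣ suc (times-p i)) × div-p (times-p i) ≡ i
      times-p-ok i i<k i∣k rewrite suc-∸1 (p*e≥1 i) =
        ℕP.*-monoʳ-≤ p i<k ,
        (*-monoʳ-∣ p i∣k , ∣m⇒∣m*n (suc i) (∣-refl {p})) ,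
        cong (_∸ 1) (trans (cong (_/ p) (ℕP.*-comm p (suc i))) (m*n/n≡m (suc i) p))
      div-p-ok : ∀ j → j < K → suc j ∣ K × p ∣ suc j → div-p j < k × suc (div-p j) ∣ k × times-p (div-p j) ≡ j
      div-p-ok j j<K (j∣K , p∣j@(divides t j≡tp)) = subst (_≤ k) (sym st) (∣⇒≤′ k≥1 t∣k) , subst (_∣ k) (sym st) t∣k , times-div
        where
        st : suc (div-p j) ≡ t
        st = trans (suc-∸1 (m≥n⇒m/n>0 (∣⇒≤ p∣j))) (trans (cong (_/ p) j≡tp) (m*n/n≡m t p))
        t∣k : t ∣ k
        t∣k = *-cancelˡ-∣ p (subst (_∣ K) (trans j≡tp (ℕP.*-comm t p)) j∣K)
        times-div : times-p (div-p j) ≡ j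
        times-div = trans (cong (λ x → p * x ∸ 1) st) (cong (_∸ 1) (trans (ℕP.*-comm p t) (sym j≡tp)))

    μ-sum-vanishes : μ-sum K ≡ + 0
    μ-sum-vanishes = begin
      μ-sum K
        ≡⟨ Σ<-cong K (λ j _ → guard-cong (suc j ∣? K) (guard-split (p ∣? suc j) (μ (suc j)))) ⟩
      Σ< K (λ j → guard (suc j ∣? K) (guard (p ∣? suc j) (μ (suc j)) ℤ.+ guard (¬? (p ∣? suc j)) (μ (suc j))))
        ≡⟨ Σ<-cong K (λ j _ → guard-∙ (suc j ∣? K) _ _) ⟩
      Σ< K (λ j → guard (suc j ∣? K) (guard (p ∣? suc j) (μ (suc j))) ℤ.+ guard (suc j ∣? K) (guard (¬? (p ∣? suc j)) (μ (suc j))))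
        ≡⟨ Σ<-∙ K _ _ ⟩
      Σ< K (λ j → guard (suc j ∣? K) (guard (p ∣? suc j) (μ (suc j))))
        ℤ.+ Σ< K (λ j → guard (suc j ∣? K) (guard (¬? (p ∣? suc j)) (μ (suc j))))
        ≡⟨ cong₂ ℤ._+_ multipleOfP-part primeToP-part ⟩
      - T ℤ.+ T ≡⟨ ℤProp.+-inverseˡ T ⟩
      + 0 ∎
      where open ≡-Reasoning

  has-prime-factor : ∀ k → 2 ≤ k → Σ[ p ∈ ℕ ] Prime p × p ∣ k
  has-prime-factor k@(suc _) 2≤k = go (factors fk) (PrimeFactorisation.isFactorisation fk) (PrimeFactorisation.factorsPrime fk)
    where
    fk = factorise k
    go : ∀ L → k ≡ product L → All Prime L → Σ[ p ∈ ℕ ] Prime p × p ∣ k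
    go [] k≡1 _ = ⊥-elim (ℕP.<⇒≢ 2≤k (sym k≡1))
    go (p ∷ L) k≡pL (p-prime ∷ _) = p , p-prime , subst (p ∣_) (sym k≡pL) (∈⇒∣product {ns = p ∷ L} (here refl))

  μ-sum-vanishes : ∀ k → 2 ≤ k → μ-sum k ≡ + 0
  μ-sum-vanishes k 2≤k with has-prime-factor k 2≤k
  ... | p , p-prime , p∣k =
    subst (λ x → μ-sum x ≡ + 0) (m*[n/m]≡n p∣k) (AtPrimeMultiple.μ-sum-vanishes p (k / p) p-prime k/p≥1)
    where
    instance _ = prime⇒nonZero p-prime
    k/p≥1 : 1 ≤ k / p
    k/p≥1 = m≥n⇒m/n>0 (∣⇒≤′ (ℕP.≤-trans (s≤s z≤n) 2≤k) p∣k)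

-- Rational identities are checked through
-- the unnormalised rationals, where they are integer identities.
module IntegerEmbedding where

  open import Data.Nat using (suc)
  import Data.Nat.Properties as ℕP
  open import Data.Integer as ℤ using (+_; -[1+_])
  import Data.Integer.Properties as ℤProp
  open import Data.Rational as ℚ using (ℚ; mkℚ; 1ℚ; toℚᵘ)
  import Data.Rational.Properties as QP
  open import Data.Rational.Unnormalised as ℚᵘ using (ℚᵘ; mkℚᵘ; *≡*) renaming (_≃_ to _≃ᵘ_)
  import Data.Rational.Unnormalised.Properties as UP
  open import Relation.Binary.PropositionalEquality
  open import Data.Nat.Coprimality using (Coprime)
  import Data.Nat.Coprimality as Coprimality

  ι : ℤ → ℚ
  ι z = z ℚ./ 1

  coprime-1 : ∀ n → Coprime n 1
  coprime-1 n = Coprimality.sym (Coprimality.1-coprimeTo n)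

  ι-as-ℚᵘ : ∀ z → toℚᵘ (ι z) ≃ᵘ mkℚᵘ z 0
  ι-as-ℚᵘ (+ n) = UP.≃-reflexive (cong toℚᵘ (QP.normalize-coprime {n} {0} (coprime-1 n)))
  ι-as-ℚᵘ -[1+ n ] = UP.≃-reflexive (cong (λ x → toℚᵘ (ℚ.- x)) (QP.normalize-coprime {suc n} {0} (coprime-1 (suc n))))

  via-ℚᵘ : ∀ {p q} (u v : ℚᵘ) → toℚᵘ p ≃ᵘ u → toℚᵘ q ≃ᵘ v → u ≃ᵘ v → p ≡ q
  via-ℚᵘ u v p≃u q≃v u≃v = QP.toℚᵘ-injective (UP.≃-trans p≃u (UP.≃-trans u≃v (UP.≃-sym q≃v)))

  ι-+ : ∀ a b → ι (a ℤ.+ b) ≡ ι a ℚ.+ ι b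
  ι-+ a b = via-ℚᵘ (mkℚᵘ (a ℤ.+ b) 0) (mkℚᵘ a 0 ℚᵘ.+ mkℚᵘ b 0) (ι-as-ℚᵘ _)
    (UP.≃-trans (QP.toℚᵘ-homo-+ (ι a) (ι b)) (UP.+-cong (ι-as-ℚᵘ a) (ι-as-ℚᵘ b)))
    (*≡* (trans (ℤProp.*-identityʳ _) (sym (trans (ℤProp.*-identityʳ _) (cong₂ ℤ._+_ (ℤProp.*-identityʳ a) (ℤProp.*-identityʳ b))))))

  ι-* : ∀ a b → ι (a ℤ.* b) ≡ ι a ℚ.* ι b
  ι-* a b = via-ℚᵘ (mkℚᵘ (a ℤ.* b) 0) (mkℚᵘ a 0 ℚᵘ.* mkℚᵘ b 0) (ι-as-ℚᵘ _)
    (UP.≃-trans (QP.toℚᵘ-homo-* (ι a) (ι b)) (UP.*-cong (ι-as-ℚᵘ a) (ι-as-ℚᵘ b)))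
    (*≡* refl)

  *-divℚ : ∀ z k → ι (+ suc k) ℚ.* divℚ z (suc k) ≡ ι z
  *-divℚ z k = via-ℚᵘ (mkℚᵘ (+ suc k) 0 ℚᵘ.* mkℚᵘ z k) (mkℚᵘ z 0)
    (UP.≃-trans (QP.toℚᵘ-homo-* (ι (+ suc k)) (z ℚ./ suc k)) (UP.*-cong (ι-as-ℚᵘ (+ suc k)) (QP.toℚᵘ-fromℚᵘ (mkℚᵘ z k))))
    (ι-as-ℚᵘ z)
    (*≡* (trans (ℤProp.*-identityʳ _) (trans (ℤProp.*-comm (+ suc k) z) (cong (λ x → z ℤ.* + suc x) (sym (ℕP.+-identityʳ k))))))

  ι-*-cancel : ∀ k x y → ι (+ suc k) ℚ.* x ≡ ι (+ suc k) ℚ.* y → x ≡ y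
  ι-*-cancel k x y e rewrite QP.normalize-coprime {suc k} {0} (coprime-1 (suc k)) = begin
    x                    ≡⟨ QP.*-identityˡ x ⟨
    1ℚ ℚ.* x             ≡⟨ cong (ℚ._* x) (QP.*-inverseˡ c) ⟨
    (ℚ.1/ c ℚ.* c) ℚ.* x ≡⟨ QP.*-assoc (ℚ.1/ c) c x ⟩
    ℚ.1/ c ℚ.* (c ℚ.* x) ≡⟨ cong (ℚ.1/ c ℚ.*_) e ⟩
    ℚ.1/ c ℚ.* (c ℚ.* y) ≡⟨ QP.*-assoc (ℚ.1/ c) c y ⟨
    (ℚ.1/ c ℚ.* c) ℚ.* y ≡⟨ cong (ℚ._* y) (QP.*-inverseˡ c) ⟩
    1ℚ ℚ.* y             ≡⟨ QP.*-identityˡ y ⟩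
    y                    ∎
    where
    open ≡-Reasoning
    c = mkℚ (+ suc k) 0 (coprime-1 (suc k))

  divℚ-unique : ∀ z k x → ι (+ suc k) ℚ.* x ≡ ι z → x ≡ divℚ z (suc k)
  divℚ-unique z k x e = ι-*-cancel k x (divℚ z (suc k)) (trans e (sym (*-divℚ z k)))

module RationalPolynomials where

  open import Data.Nat using (zero; suc)
  open import Data.Rational as ℚ using (ℚ; 0ℚ; 1ℚ)
  import Data.Rational.Properties as QP
  open import Data.List using ([]; _∷_; map)
  open import Relation.Binary.PropositionalEquality as Eq using (refl; cong; cong₂)
  open import Relation.Binary.Structures using (IsEquivalence)
  open import Relation.Binary.Bundles using (Setoid)

  open ℚP public

  -- Equality of polynomials; a record (rather than Defs' function type ≈P)
  -- so that Agda can infer the two polynomials from an equation.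
  infix 4 _≈_
  record _≈_ (p r : Poly) : Set where
    constructor mk≈
    field get : p ≈P r
  open _≈_ public

  ≈-refl : ∀ {p} → p ≈ p
  ≈-refl = mk≈ λ k → refl

  ≈-sym : ∀ {p r} → p ≈ r → r ≈ p
  ≈-sym e = mk≈ λ k → Eq.sym (get e k)

  ≈-trans : ∀ {p r s} → p ≈ r → r ≈ s → p ≈ s
  ≈-trans e f = mk≈ λ k → Eq.trans (get e k) (get f k)

  ≈-reflexive : ∀ {p r} → p ≡ r → p ≈ r
  ≈-reflexive refl = ≈-refl

  ≈-isEquivalence : IsEquivalence _≈_
  ≈-isEquivalence = record { refl = ≈-refl ; sym = ≈-sym ; trans = ≈-trans }

  ≈-setoid : Setoid _ _
  ≈-setoid = record { isEquivalence = ≈-isEquivalence }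

  ∷-cong : ∀ {a b p r} → a ≡ b → p ≈ r → (a ∷ p) ≈ (b ∷ r)
  ∷-cong e f = mk≈ λ { zero → e ; (suc k) → get f k }

  tail-≈ : ∀ {a b p r} → (a ∷ p) ≈ (b ∷ r) → p ≈ r
  tail-≈ e = mk≈ λ k → get e (suc k)

  0∷≈[] : ∀ {p} → p ≈ [] → (0ℚ ∷ p) ≈ []
  0∷≈[] e = mk≈ λ { zero → refl ; (suc k) → get e k }

  coeff-⊕ : ∀ p r k → coeff (p ⊕ r) k ≡ coeff p k ℚ.+ coeff r k
  coeff-⊕ [] r k = Eq.sym (QP.+-identityˡ _)
  coeff-⊕ (a ∷ p) [] k = Eq.sym (QP.+-identityʳ _)
  coeff-⊕ (a ∷ p) (b ∷ r) zero = refl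
  coeff-⊕ (a ∷ p) (b ∷ r) (suc k) = coeff-⊕ p r k

  coeff-scale : ∀ c p k → coeff (scale c p) k ≡ c ℚ.* coeff p k
  coeff-scale c [] k = Eq.sym (QP.*-zeroʳ c)
  coeff-scale c (a ∷ p) zero = refl
  coeff-scale c (a ∷ p) (suc k) = coeff-scale c p k

  coeff-neg : ∀ p k → coeff (map ℚ.-_ p) k ≡ ℚ.- coeff p k
  coeff-neg [] k = refl
  coeff-neg (a ∷ p) zero = refl
  coeff-neg (a ∷ p) (suc k) = coeff-neg p k

  ⊕-cong : ∀ {p p' r r'} → p ≈ p' → r ≈ r' → (p ⊕ r) ≈ (p' ⊕ r')
  ⊕-cong {p} {p'} {r} {r'} e f =
    mk≈ λ k → Eq.trans (coeff-⊕ p r k) (Eq.trans (cong₂ ℚ._+_ (get e k) (get f k)) (Eq.sym (coeff-⊕ p' r' k)))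

  ⊕-comm : ∀ p r → (p ⊕ r) ≈ (r ⊕ p)
  ⊕-comm p r = mk≈ λ k → Eq.trans (coeff-⊕ p r k) (Eq.trans (QP.+-comm (coeff p k) (coeff r k)) (Eq.sym (coeff-⊕ r p k)))

  ⊕-assoc : ∀ p r s → ((p ⊕ r) ⊕ s) ≈ (p ⊕ (r ⊕ s))
  ⊕-assoc p r s = mk≈ λ k → begin
    coeff ((p ⊕ r) ⊕ s) k                   ≡⟨ coeff-⊕ (p ⊕ r) s k ⟩
    coeff (p ⊕ r) k ℚ.+ coeff s k           ≡⟨ cong (ℚ._+ coeff s k) (coeff-⊕ p r k) ⟩
    (coeff p k ℚ.+ coeff r k) ℚ.+ coeff s k ≡⟨ QP.+-assoc (coeff p k) (coeff r k) (coeff s k) ⟩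
    coeff p k ℚ.+ (coeff r k ℚ.+ coeff s k) ≡⟨ cong (coeff p k ℚ.+_) (coeff-⊕ r s k) ⟨
    coeff p k ℚ.+ coeff (r ⊕ s) k           ≡⟨ coeff-⊕ p (r ⊕ s) k ⟨
    coeff (p ⊕ (r ⊕ s)) k                   ∎
    where open Eq.≡-Reasoning

  ⊕-identityʳ : ∀ p → (p ⊕ []) ≈ p
  ⊕-identityʳ [] = ≈-refl
  ⊕-identityʳ (a ∷ p) = ≈-refl

  ⊕-commutativeMonoid : CommutativeMonoid _ _
  ⊕-commutativeMonoid = record
    { Carrier = Poly ; _≈_ = _≈_ ; _∙_ = _⊕_ ; ε = []
    ; isCommutativeMonoid = record
      { isMonoid = record
        { isSemigroup = record
          { isMagma = record { isEquivalence = ≈-isEquivalence ; ∙-cong = ⊕-cong }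
          ; assoc = ⊕-assoc }
        ; identity = (λ p → ≈-refl) , ⊕-identityʳ }
      ; comm = ⊕-comm } }

  open import Algebra.Properties.CommutativeSemigroup
    (CommutativeMonoid.commutativeSemigroup ⊕-commutativeMonoid) using () renaming (interchange to ⊕-interchange)

  scale-cong : ∀ c {p r} → p ≈ r → scale c p ≈ scale c r
  scale-cong c {p} {r} e = mk≈ λ k → Eq.trans (coeff-scale c p k) (Eq.trans (cong (c ℚ.*_) (get e k)) (Eq.sym (coeff-scale c r k)))

  scale-⊕ : ∀ c p r → scale c (p ⊕ r) ≈ (scale c p ⊕ scale c r)
  scale-⊕ c p r = mk≈ λ k → Eq.trans (coeff-scale c (p ⊕ r) k) (Eq.trans (cong (c ℚ.*_) (coeff-⊕ p r k))
    (Eq.trans (QP.*-distribˡ-+ c _ _) (Eq.sym (Eq.trans (coeff-⊕ (scale c p) (scale c r) k) (cong₂ ℚ._+_ (coeff-scale c p k) (coeff-scale c r k))))))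

  scale-+ : ∀ c d p → scale (c ℚ.+ d) p ≈ (scale c p ⊕ scale d p)
  scale-+ c d p = mk≈ λ k → Eq.trans (coeff-scale (c ℚ.+ d) p k) (Eq.trans (QP.*-distribʳ-+ _ c d)
    (Eq.sym (Eq.trans (coeff-⊕ (scale c p) (scale d p) k) (cong₂ ℚ._+_ (coeff-scale c p k) (coeff-scale d p k)))))

  scale-* : ∀ c d p → scale (c ℚ.* d) p ≈ scale c (scale d p)
  scale-* c d p = mk≈ λ k → Eq.trans (coeff-scale (c ℚ.* d) p k) (Eq.trans (QP.*-assoc c d _)
    (Eq.sym (Eq.trans (coeff-scale c (scale d p) k) (cong (c ℚ.*_) (coeff-scale d p k)))))

  scale-1 : ∀ p → scale 1ℚ p ≈ p
  scale-1 p = mk≈ λ k → Eq.trans (coeff-scale 1ℚ p k) (QP.*-identityˡ _)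

  scale-0 : ∀ p → scale 0ℚ p ≈ []
  scale-0 p = mk≈ λ k → Eq.trans (coeff-scale 0ℚ p k) (QP.*-zeroˡ (coeff p k))

  0∷-⊕ : ∀ p r → ((0ℚ ∷ p) ⊕ (0ℚ ∷ r)) ≈ (0ℚ ∷ (p ⊕ r))
  0∷-⊕ p r = ∷-cong (QP.+-identityˡ 0ℚ) ≈-refl

  ⊗-[] : ∀ p → (p ⊗ []) ≈ []
  ⊗-[] [] = ≈-refl
  ⊗-[] (a ∷ p) = 0∷≈[] (⊗-[] p)

  ⊗-congʳ : ∀ p {r r'} → r ≈ r' → (p ⊗ r) ≈ (p ⊗ r')
  ⊗-congʳ [] e = ≈-refl
  ⊗-congʳ (a ∷ p) e = ⊕-cong (scale-cong a e) (∷-cong refl (⊗-congʳ p e))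

  ⊗-consʳ : ∀ p b r → (p ⊗ (b ∷ r)) ≈ (scale b p ⊕ (0ℚ ∷ (p ⊗ r)))
  ⊗-consʳ [] b r = ≈-sym (0∷≈[] ≈-refl)
  ⊗-consʳ (a ∷ p) b r = ∷-cong (Eq.trans (QP.+-identityʳ _) (Eq.trans (QP.*-comm a b) (Eq.sym (QP.+-identityʳ _))))
    (≈-trans (⊕-cong (≈-refl {scale a r}) (⊗-consʳ p b r))
    (≈-trans (≈-sym (⊕-assoc (scale a r) (scale b p) _))
    (≈-trans (⊕-cong (⊕-comm (scale a r) (scale b p)) ≈-refl) (⊕-assoc (scale b p) (scale a r) _))))

  ⊗-comm : ∀ p r → (p ⊗ r) ≈ (r ⊗ p)
  ⊗-comm [] r = ≈-sym (⊗-[] r)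
  ⊗-comm (a ∷ p) r = ≈-trans (⊕-cong (≈-refl {scale a r}) (∷-cong refl (⊗-comm p r))) (≈-sym (⊗-consʳ r a p))

  ⊗-congˡ : ∀ {p p'} r → p ≈ p' → (p ⊗ r) ≈ (p' ⊗ r)
  ⊗-congˡ {p} {p'} r e = ≈-trans (⊗-comm p r) (≈-trans (⊗-congʳ r e) (⊗-comm r p'))

  ⊗-distribʳ : ∀ p q r → ((p ⊕ q) ⊗ r) ≈ ((p ⊗ r) ⊕ (q ⊗ r))
  ⊗-distribʳ [] q r = ≈-refl
  ⊗-distribʳ (a ∷ p) [] r = ≈-sym (⊕-identityʳ _)
  ⊗-distribʳ (a ∷ p) (b ∷ q) r =
    ≈-trans (⊕-cong (scale-+ a b r) (≈-trans (∷-cong refl (⊗-distribʳ p q r)) (≈-sym (0∷-⊕ (p ⊗ r) (q ⊗ r)))))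
            (⊕-interchange (scale a r) (scale b r) (0ℚ ∷ (p ⊗ r)) (0ℚ ∷ (q ⊗ r)))

  ⊗-distribˡ : ∀ p q r → (p ⊗ (q ⊕ r)) ≈ ((p ⊗ q) ⊕ (p ⊗ r))
  ⊗-distribˡ p q r = ≈-trans (⊗-comm p (q ⊕ r)) (≈-trans (⊗-distribʳ q r p) (⊕-cong (⊗-comm q p) (⊗-comm r p)))

  ⊗-scaleˡ : ∀ c p r → (scale c p ⊗ r) ≈ scale c (p ⊗ r)
  ⊗-scaleˡ c [] r = ≈-refl
  ⊗-scaleˡ c (a ∷ p) r = ≈-trans (⊕-cong (scale-* c a r) (∷-cong (Eq.sym (QP.*-zeroʳ c)) (⊗-scaleˡ c p r)))
    (≈-sym (scale-⊕ c (scale a r) (0ℚ ∷ (p ⊗ r))))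

  0∷-⊗ : ∀ p r → ((0ℚ ∷ p) ⊗ r) ≈ (0ℚ ∷ (p ⊗ r))
  0∷-⊗ p r = ⊕-cong (scale-0 r) ≈-refl

  ⊗-assoc : ∀ p q r → ((p ⊗ q) ⊗ r) ≈ (p ⊗ (q ⊗ r))
  ⊗-assoc [] q r = ≈-refl
  ⊗-assoc (a ∷ p) q r = ≈-trans (⊗-distribʳ (scale a q) (0ℚ ∷ (p ⊗ q)) r)
    (⊕-cong (⊗-scaleˡ a q r) (≈-trans (0∷-⊗ (p ⊗ q) r) (∷-cong refl (⊗-assoc p q r))))

  const-⊗ : ∀ c p → ((c ∷ []) ⊗ p) ≈ scale c p
  const-⊗ c p = mk≈ λ k → Eq.trans (coeff-⊕ (scale c p) (0ℚ ∷ []) k) (Eq.trans (cong (coeff (scale c p) k ℚ.+_) (zero-coeff k)) (QP.+-identityʳ _))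
    where
    zero-coeff : ∀ k → coeff (0ℚ ∷ []) k ≡ 0ℚ
    zero-coeff zero = refl
    zero-coeff (suc k) = refl

  ⊖-from-⊕ : ∀ p r s → p ≈ (r ⊕ s) → (p ⊖ r) ≈ s
  ⊖-from-⊕ p r s e = mk≈ λ k → Eq.trans (coeff-⊕ p (map ℚ.-_ r) k)
    (Eq.trans (cong₂ ℚ._+_ (Eq.trans (get e k) (coeff-⊕ r s k)) (coeff-neg r k)) (cancel (coeff r k) (coeff s k)))
    where
    open import Data.Rational.Solver
    open +-*-Solver
    cancel : ∀ x y → (x ℚ.+ y) ℚ.+ (ℚ.- x) ≡ y
    cancel = solve 2 (λ x y → (x :+ y) :+ (:- x) := y) refl

module SubstitutionAndEvaluation where

  open import Data.Nat using (zero; suc; _+_)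
  open import Data.Integer as ℤ using (+_)
  open import Data.Rational as ℚ using (ℚ; 0ℚ; 1ℚ)
  import Data.Rational.Properties as QP
  open import Data.List using ([]; _∷_; replicate; _++_)
  open import Relation.Binary.PropositionalEquality as Eq using (refl; cong; cong₂)

  open IntegerEmbedding
  open RationalPolynomials

  -- sh d p = q^d · p
  sh : ℕ → Poly → Poly
  sh d p = replicate d 0ℚ ++ p

  sh-[] : ∀ d → sh d [] ≈ []
  sh-[] zero = ≈-refl
  sh-[] (suc d) = 0∷≈[] (sh-[] d)

  sh-cong : ∀ d {p r} → p ≈ r → sh d p ≈ sh d r
  sh-cong zero e = e
  sh-cong (suc d) e = ∷-cong refl (sh-cong d e)

  sh-⊕ : ∀ d p r → sh d (p ⊕ r) ≈ (sh d p ⊕ sh d r)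
  sh-⊕ zero p r = ≈-refl
  sh-⊕ (suc d) p r = ≈-trans (∷-cong refl (sh-⊕ d p r)) (≈-sym (0∷-⊕ (sh d p) (sh d r)))

  sh-scale : ∀ d c p → sh d (scale c p) ≈ scale c (sh d p)
  sh-scale zero c p = ≈-refl
  sh-scale (suc d) c p = ∷-cong (Eq.sym (QP.*-zeroʳ c)) (sh-scale d c p)

  sh-⊗ : ∀ d p r → (sh d p ⊗ r) ≈ sh d (p ⊗ r)
  sh-⊗ zero p r = ≈-refl
  sh-⊗ (suc d) p r = ≈-trans (0∷-⊗ (sh d p) r) (∷-cong refl (sh-⊗ d p r))

  sh-sh : ∀ a b p → sh a (sh b p) ≡ sh (a + b) p
  sh-sh zero b p = refl
  sh-sh (suc a) b p = cong (0ℚ ∷_) (sh-sh a b p)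

  module SubstPow (d : ℕ) where
    D = suc d

    sp : Poly → Poly
    sp = subst-pow D

    sp-cons : ∀ a p → sp (a ∷ p) ≈ (a ∷ sh d (sp p))
    sp-cons a [] = ∷-cong refl (≈-sym (sh-[] d))
    sp-cons a (b ∷ p) = ≈-refl

    sp-≈[] : ∀ p → p ≈ [] → sp p ≈ []
    sp-≈[] [] e = ≈-refl
    sp-≈[] (a ∷ p) e = ≈-trans (sp-cons a p) (Eq.subst (λ x → (x ∷ sh d (sp p)) ≈ [])
      (Eq.sym (get e 0)) (0∷≈[] (≈-trans (sh-cong d (sp-≈[] p (mk≈ λ k → get e (suc k)))) (sh-[] d))))

    sp-cong : ∀ {p r} → p ≈ r → sp p ≈ sp r
    sp-cong {[]} {r} e = ≈-sym (sp-≈[] r (≈-sym e))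
    sp-cong {a ∷ p} {[]} e = sp-≈[] (a ∷ p) e
    sp-cong {a ∷ p} {b ∷ r} e =
      ≈-trans (sp-cons a p) (≈-trans (∷-cong (get e 0) (sh-cong d (sp-cong (tail-≈ e)))) (≈-sym (sp-cons b r)))

    sp-⊕ : ∀ p r → sp (p ⊕ r) ≈ (sp p ⊕ sp r)
    sp-⊕ [] r = ≈-refl
    sp-⊕ (a ∷ p) [] = ≈-sym (⊕-identityʳ _)
    sp-⊕ (a ∷ p) (b ∷ r) = ≈-trans (sp-cons (a ℚ.+ b) (p ⊕ r))
      (≈-trans (∷-cong refl (≈-trans (sh-cong d (sp-⊕ p r)) (sh-⊕ d (sp p) (sp r))))
      (≈-sym (⊕-cong (sp-cons a p) (sp-cons b r))))

    sp-scale : ∀ c p → sp (scale c p) ≈ scale c (sp p)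
    sp-scale c [] = ≈-refl
    sp-scale c (a ∷ p) = ≈-trans (sp-cons (c ℚ.* a) (scale c p))
      (≈-trans (∷-cong refl (≈-trans (sh-cong d (sp-scale c p)) (sh-scale d c (sp p))))
      (≈-sym (scale-cong c (sp-cons a p))))

    sp-⊗ : ∀ p r → sp (p ⊗ r) ≈ (sp p ⊗ sp r)
    sp-⊗ [] r = ≈-refl
    sp-⊗ (a ∷ p) r = ≈-trans (sp-⊕ (scale a r) (0ℚ ∷ (p ⊗ r)))
      (≈-trans (⊕-cong (sp-scale a r) (≈-trans (sp-cons 0ℚ (p ⊗ r)) (sh-cong D (sp-⊗ p r))))
      (≈-sym (≈-trans (⊗-congˡ (sp r) (sp-cons a p))
        (⊕-cong (≈-refl {scale a (sp r)}) (∷-cong refl (sh-⊗ d (sp p) (sp r)))))))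

    sp-sh : ∀ m p → sp (sh m p) ≈ sh (m * D) (sp p)
    sp-sh zero p = ≈-refl
    sp-sh (suc m) p = ≈-trans (sp-cons 0ℚ (sh m p)) (≈-trans (sh-cong D (sp-sh m p)) (≈-reflexive (sh-sh D (m * D) (sp p))))

  subst-pow-cong : ∀ {k p r} → 1 ≤ k → p ≈ r → subst-pow k p ≈ subst-pow k r
  subst-pow-cong {suc k} _ = SubstPow.sp-cong k

  subst-pow-1 : ∀ p → subst-pow 1 p ≈ p
  subst-pow-1 [] = ≈-refl
  subst-pow-1 (a ∷ p) = ≈-trans (SubstPow.sp-cons 0 a p) (∷-cong refl (subst-pow-1 p))

  subst-pow-∘ : ∀ e f p → subst-pow (suc f) (subst-pow (suc e) p) ≈ subst-pow (suc e * suc f) p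
  subst-pow-∘ e f [] = ≈-refl
  subst-pow-∘ e f (a ∷ p) = ≈-trans (F.sp-cong (E.sp-cons a p))
    (≈-trans (F.sp-cons a (sh e (E.sp p)))
    (≈-trans (∷-cong refl (sh-cong f (≈-trans (F.sp-sh e (E.sp p)) (sh-cong (e * suc f) (subst-pow-∘ e f p)))))
    (≈-trans (∷-cong refl (≈-reflexive (sh-sh f (e * suc f) _)))
    (≈-sym (EF.sp-cons a p)))))
    where
    module E = SubstPow e
    module F = SubstPow f
    module EF = SubstPow (f + e * suc f)

  eval-≈[] : ∀ p → p ≈ [] → eval1 p ≡ 0ℚ
  eval-≈[] [] e = refl
  eval-≈[] (a ∷ p) e = cong₂ ℚ._+_ (get e 0) (eval-≈[] p (mk≈ λ k → get e (suc k)))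

  eval-cong : ∀ {p r} → p ≈ r → eval1 p ≡ eval1 r
  eval-cong {[]} {r} e = Eq.sym (eval-≈[] r (≈-sym e))
  eval-cong {a ∷ p} {[]} e = eval-≈[] (a ∷ p) e
  eval-cong {a ∷ p} {b ∷ r} e = cong₂ ℚ._+_ (get e 0) (eval-cong (tail-≈ e))

  eval-⊕ : ∀ p r → eval1 (p ⊕ r) ≡ eval1 p ℚ.+ eval1 r
  eval-⊕ [] r = Eq.sym (QP.+-identityˡ _)
  eval-⊕ (a ∷ p) [] = Eq.sym (QP.+-identityʳ _)
  eval-⊕ (a ∷ p) (b ∷ r) = Eq.trans (cong ((a ℚ.+ b) ℚ.+_) (eval-⊕ p r)) (+-interchange a b (eval1 p) (eval1 r))
    where open import Algebra.Properties.CommutativeSemigroup (CommutativeMonoid.commutativeSemigroup QP.+-0-commutativeMonoid) renaming (interchange to +-interchange)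

  eval-scale : ∀ c p → eval1 (scale c p) ≡ c ℚ.* eval1 p
  eval-scale c [] = Eq.sym (QP.*-zeroʳ c)
  eval-scale c (a ∷ p) = Eq.trans (cong ((c ℚ.* a) ℚ.+_) (eval-scale c p)) (Eq.sym (QP.*-distribˡ-+ c a (eval1 p)))

  eval-⊗ : ∀ p r → eval1 (p ⊗ r) ≡ eval1 p ℚ.* eval1 r
  eval-⊗ [] r = Eq.sym (QP.*-zeroˡ (eval1 r))
  eval-⊗ (a ∷ p) r = Eq.trans (eval-⊕ (scale a r) (0ℚ ∷ (p ⊗ r)))
    (Eq.trans (cong₂ ℚ._+_ (eval-scale a r) (Eq.trans (QP.+-identityˡ _) (eval-⊗ p r)))
    (Eq.sym (QP.*-distribʳ-+ (eval1 r) a (eval1 p))))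

  eval-sh : ∀ d p → eval1 (sh d p) ≡ eval1 p
  eval-sh zero p = refl
  eval-sh (suc d) p = Eq.trans (QP.+-identityˡ _) (eval-sh d p)

  eval-subst-pow : ∀ d p → eval1 (subst-pow (suc d) p) ≡ eval1 p
  eval-subst-pow d [] = refl
  eval-subst-pow d (a ∷ p) =
    Eq.trans (eval-cong (SubstPow.sp-cons d a p)) (cong (a ℚ.+_) (Eq.trans (eval-sh d _) (eval-subst-pow d p)))

  eval-qint : ∀ d → eval1 (qint d) ≡ ι (+ d)
  eval-qint zero = refl
  eval-qint (suc d) = Eq.trans (cong (1ℚ ℚ.+_) (eval-qint d)) (Eq.sym (ι-+ (+ 1) (+ d)))

  q-1 : Poly
  q-1 = ℚ.- 1ℚ ∷ 1ℚ ∷ []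

  qᵈ-1 : ℕ → Poly
  qᵈ-1 d = (ℚ.- 1ℚ ∷ []) ⊕ sh d (1ℚ ∷ [])

  qint-⊗-q-1 : ∀ d → (qint d ⊗ q-1) ≈ qᵈ-1 d
  qint-⊗-q-1 zero = mk≈ λ { zero → refl ; (suc k) → refl }
  qint-⊗-q-1 (suc d) = ≈-trans unfold (∷-cong refl telescope)
    where
    unfold : (qint (suc d) ⊗ q-1) ≈ (q-1 ⊕ (0ℚ ∷ qᵈ-1 d))
    unfold = ⊕-cong {scale 1ℚ q-1} {q-1} {0ℚ ∷ (qint d ⊗ q-1)} {0ℚ ∷ qᵈ-1 d} (scale-1 q-1) (∷-cong refl (qint-⊗-q-1 d))
    telescope : ((1ℚ ∷ []) ⊕ qᵈ-1 d) ≈ sh d (1ℚ ∷ [])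
    telescope = ≈-trans (≈-sym (⊕-assoc (1ℚ ∷ []) (ℚ.- 1ℚ ∷ []) (sh d (1ℚ ∷ []))))
       (mk≈ λ k → Eq.trans (coeff-⊕ (0ℚ ∷ []) (sh d (1ℚ ∷ [])) k)
                  (Eq.trans (cong (ℚ._+ coeff (sh d (1ℚ ∷ [])) k) (zero-coeff k)) (QP.+-identityˡ _)))
      where
      zero-coeff : ∀ k → coeff (0ℚ ∷ []) k ≡ 0ℚ
      zero-coeff zero = refl
      zero-coeff (suc k) = refl

  subst-pow-q-1 : ∀ k → subst-pow (suc k) q-1 ≈ qᵈ-1 (suc k)
  subst-pow-q-1 k = ∷-cong (Eq.sym (QP.+-identityʳ (ℚ.- 1ℚ))) ≈-refl

  -- [d]_{q^K} (q^K - 1) = [dK]_q (q - 1): both sides are q^{dK} - 1.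
  qint-subst-pow : ∀ d k → (subst-pow (suc k) (qint d) ⊗ qᵈ-1 (suc k)) ≈ (qint (d * suc k) ⊗ q-1)
  qint-subst-pow d k = begin
    K.sp (qint d) ⊗ qᵈ-1 (suc k)  ≈⟨ ⊗-congʳ (K.sp (qint d)) (subst-pow-q-1 k) ⟨
    K.sp (qint d) ⊗ K.sp q-1      ≈⟨ K.sp-⊗ (qint d) q-1 ⟨
    K.sp (qint d ⊗ q-1)           ≈⟨ K.sp-cong (qint-⊗-q-1 d) ⟩
    K.sp (qᵈ-1 d)                 ≈⟨ ≈-trans (K.sp-⊕ (ℚ.- 1ℚ ∷ []) (sh d (1ℚ ∷ []))) (⊕-cong ≈-refl (K.sp-sh d (1ℚ ∷ []))) ⟩
    qᵈ-1 (d * suc k)              ≈⟨ qint-⊗-q-1 (d * suc k) ⟨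
    qint (d * suc k) ⊗ q-1        ∎
    where
    module K = SubstPow k
    open import Relation.Binary.Reasoning.Setoid ≈-setoid

  -- Factor theorem at q = 1:  p = p(1) + (q - 1) · p÷[q-1]  where the
  -- coefficients of p÷[q-1] are the tail sums of those of p.
  _÷[q-1] : Poly → Poly
  [] ÷[q-1] = []
  (a ∷ p) ÷[q-1] = eval1 p ∷ (p ÷[q-1])

  factor-at-1 : ∀ p → ((q-1 ⊗ (p ÷[q-1])) ⊕ (eval1 p ∷ [])) ≈ p
  factor-at-1 [] = mk≈ λ { zero → refl ; (suc zero) → refl ; (suc (suc k)) → refl }
  factor-at-1 (a ∷ p) = ≈-trans (⊕-cong (⊗-consʳ q-1 E (p ÷[q-1])) (≈-refl {(a ℚ.+ E) ∷ []}))
    (∷-cong (constant-term E a)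
      (≈-trans (⊕-identityʳ _) (≈-trans (⊕-cong (∷-cong (QP.*-identityʳ E) ≈-refl) (≈-refl {q-1 ⊗ (p ÷[q-1])}))
      (≈-trans (⊕-comm (E ∷ []) (q-1 ⊗ (p ÷[q-1]))) (factor-at-1 p)))))
    where
    E = eval1 p
    open import Data.Rational.Solver
    open +-*-Solver
    constant-term : ∀ E a → (E ℚ.* (ℚ.- 1ℚ) ℚ.+ 0ℚ) ℚ.+ (a ℚ.+ E) ≡ a
    constant-term = solve 2 (λ E a → (E :* (:- con 1ℚ) :+ con 0ℚ) :+ (a :+ E) := a) refl

module IntegerToRational where

  open import Data.Nat using (zero; suc; _/_)
  open import Data.Nat.Divisibility using (_∣?_)
  open import Data.Integer as ℤ using (+_)
  open import Data.Rational as ℚ using (0ℚ)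
  open import Data.List using (List; []; _∷_; map; replicate; _++_; filter; upTo)
  open import Data.List.Properties using (map-++; map-replicate; map-∘)
  open import Relation.Binary.PropositionalEquality using (refl; cong; cong₂; trans; sym)

  open IntegerEmbedding
  open RationalPolynomials

  toℚP-⊕ : ∀ p r → toℚP (p ℤP.⊕ r) ≡ (toℚP p ⊕ toℚP r)
  toℚP-⊕ [] r = refl
  toℚP-⊕ (a ∷ p) [] = refl
  toℚP-⊕ (a ∷ p) (b ∷ r) = cong₂ _∷_ (ι-+ a b) (toℚP-⊕ p r)

  toℚP-scale : ∀ c p → toℚP (ℤP.scale c p) ≡ scale (ι c) (toℚP p)
  toℚP-scale c [] = refl
  toℚP-scale c (a ∷ p) = cong₂ _∷_ (ι-* c a) (toℚP-scale c p)

  toℚP-⊗ : ∀ p r → toℚP (p ℤP.⊗ r) ≡ (toℚP p ⊗ toℚP r)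
  toℚP-⊗ [] r = refl
  toℚP-⊗ (a ∷ p) r = trans (toℚP-⊕ (ℤP.scale a r) (+ 0 ∷ (p ℤP.⊗ r)))
    (cong₂ _⊕_ (toℚP-scale a r) (cong (0ℚ ∷_) (toℚP-⊗ p r)))

  toℚP-subst-pow : ∀ d p → toℚP (ℤP.subst-pow d p) ≡ subst-pow d (toℚP p)
  toℚP-subst-pow d [] = refl
  toℚP-subst-pow d (a ∷ []) = refl
  toℚP-subst-pow d (a ∷ b ∷ p) = cong (ι a ∷_) (trans (map-++ ι (replicate (d ∸ 1) (+ 0)) (ℤP.subst-pow d (b ∷ p)))
    (cong₂ _++_ (map-replicate ι (d ∸ 1) (+ 0)) (toℚP-subst-pow d (b ∷ p))))

  toℚP-qint : ∀ d → toℚP (ℤP.qint d) ≡ qint d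
  toℚP-qint d = map-replicate ι d (+ 1)

  toℚP-eval1 : ∀ p → ι (ℤP.eval1 p) ≡ eval1 (toℚP p)
  toℚP-eval1 [] = refl
  toℚP-eval1 (a ∷ p) = trans (ι-+ a (ℤP.eval1 p)) (cong (ι a ℚ.+_) (toℚP-eval1 p))

  toℚP-coeff : ∀ p k → coeff (toℚP p) k ≡ ι (ℤP.coeff p k)
  toℚP-coeff [] k = refl
  toℚP-coeff (a ∷ p) zero = refl
  toℚP-coeff (a ∷ p) (suc k) = toℚP-coeff p k

  toℚP-≈ : ∀ {p r} → p ℤP.≈P r → toℚP p ≈ toℚP r
  toℚP-≈ {p} {r} e = mk≈ λ k → trans (toℚP-coeff p k) (trans (cong ι (e k)) (sym (toℚP-coeff r k)))

  toℚP-sumP : ∀ L → toℚP (ℤP.sumP L) ≡ sumP (map toℚP L)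
  toℚP-sumP [] = refl
  toℚP-sumP (p ∷ L) = trans (toℚP-⊕ p (ℤP.sumP L)) (cong (toℚP p ⊕_) (toℚP-sumP L))

  toℚP-divSum : ∀ n f → toℚP (ℤP.divSum n f) ≡ divSum n (λ d e → toℚP (f d e))
  toℚP-divSum n f = trans (toℚP-sumP (map term divisors)) (cong sumP (sym (map-∘ divisors)))
    where
    term = λ k → f (suc k) (n / suc k)
    divisors = filter (λ k → suc k ∣? n) (upTo n)

module PolynomialDivisorSums where

  open import Data.Nat using (suc; _≟_)
  import Data.Nat.Properties as ℕP
  open import Data.Nat.Divisibility
  open import Data.Nat.DivMod using (_/_; m*n/n≡m)
  import Data.Integer.Properties as ℤProp
  open import Data.Rational as ℚ using (ℚ)
  import Data.Rational.Properties as QP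
  open import Data.List using ([]; filter; upTo)
  open import Data.List.Properties using (map-cong)
  open import Relation.Nullary using (Dec; yes; no)
  open import Relation.Nullary.Decidable using (_×-dec_; ¬?)
  open import Relation.Unary using (Pred; Decidable)
  open import Relation.Binary.PropositionalEquality as Eq using (cong; _≢_)
  open import Function using (id)

  open Arithmetic
  open MöbiusSum using (μ-sum; μ-sum-vanishes)
  open IntegerEmbedding
  open RationalPolynomials
  open SubstitutionAndEvaluation

  module PD = DivisorSums ⊕-commutativeMonoid
  module QD = DivisorSums QP.+-0-commutativeMonoid
  module ZD = DivisorSums ℤProp.+-0-commutativeMonoid

  divSum-cong : ∀ d (f f' : ℕ → ℕ → Poly) → (∀ x y → f x y ≡ f' x y) → divSum d f ≡ divSum d f'
  divSum-cong d f f' h = cong sumP (map-cong (λ k → h (suc k) (d / suc k)) (filter (λ k → suc k ∣? d) (upTo d)))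

  divSum-as-DS : ∀ d (f : ℕ → ℕ → Poly) → divSum d f ≈ PD.DS d (λ e → f e (d /' e))
  divSum-as-DS d f = PD.foldr-filter (λ k → suc k ∣? d) (λ k → f (suc k) (d / suc k)) id d

  subst-pow-Σ< : ∀ k N {p} {P : Pred ℕ p} (P? : Decidable P) (F : ℕ → Poly) →
    subst-pow (suc k) (PD.Σ< N (λ j → PD.guard (P? j) (F j))) ≈ PD.Σ< N (λ j → PD.guard (P? j) (subst-pow (suc k) (F j)))
  subst-pow-Σ< k = SumHomomorphism.Σ<-guard-hom ⊕-commutativeMonoid ⊕-commutativeMonoid
    (subst-pow (suc k)) ≈-refl (SubstPow.sp-⊕ k)

  scale-Σ< : ∀ N {p} {P : Pred ℕ p} (P? : Decidable P) (c : ℕ → ℚ) X →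
    scale (QD.Σ< N (λ j → QD.guard (P? j) (c j))) X ≈ PD.Σ< N (λ j → PD.guard (P? j) (scale (c j) X))
  scale-Σ< N P? c X = SumHomomorphism.Σ<-guard-hom QP.+-0-commutativeMonoid ⊕-commutativeMonoid
    (λ c → scale c X) (scale-0 X) (λ x y → scale-+ x y X) N P? c

  ι-Σ< : ∀ N {p} {P : Pred ℕ p} (P? : Decidable P) (c : ℕ → ℤ) →
    ι (ZD.Σ< N (λ j → ZD.guard (P? j) (c j))) ≡ QD.Σ< N (λ j → QD.guard (P? j) (ι (c j)))
  ι-Σ< = SumHomomorphism.Σ<-guard-hom ℤProp.+-0-commutativeMonoid QP.+-0-commutativeMonoid ι Eq.refl ι-+

  gaussSum : (ℕ → Poly) → ℕ → Poly
  gaussSum b d = PD.DS d (λ e → scale (ι (μ e)) (subst-pow e (b (d /' e))))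

  gaussSum-subst-pow : ∀ b d k → 1 ≤ k →
    subst-pow k (gaussSum b d) ≈ PD.DS d (λ e → scale (ι (μ e)) (subst-pow (e * k) (b (d /' e))))
  gaussSum-subst-pow b d (suc k) _ = ≈-trans (subst-pow-Σ< k d (λ j → suc j ∣? d) _)
    (PD.Σ<-cong d (λ j _ → PD.guard-cong (suc j ∣? d)
      (≈-trans (SubstPow.sp-scale k (ι (μ (suc j))) _) (scale-cong (ι (μ (suc j))) (subst-pow-∘ j k (b (d /' suc j)))))))

  eval-gaussSum : ∀ b d → eval1 (gaussSum b d) ≡ QD.DS d (λ e → ι (μ e) ℚ.* eval1 (b (d /' e)))
  eval-gaussSum b d = Eq.trans
    (SumHomomorphism.Σ<-guard-hom ⊕-commutativeMonoid QP.+-0-commutativeMonoid eval1 Eq.refl eval-⊕ d (λ k → suc k ∣? d) _)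
    (QD.Σ<-cong d (λ i _ → QD.guard-cong (suc i ∣? d)
      (Eq.trans (eval-scale (ι (μ (suc i))) (subst-pow (suc i) (b (d /' suc i)))) (cong (ι (μ (suc i)) ℚ.*_) (eval-subst-pow i (b (d /' suc i)))))))

  -- Möbius inversion:  ∑_{d ∣ n} C_d(q^{n/d}) = b_n(q).
  -- Writing d = e f, the left side is ∑_{f ∣ n} (∑_{e ∣ n/f} μ(e)) b_f(q^{n/f}),
  -- and the inner sum vanishes unless f = n.
  möbius-inversion : ∀ n (b : ℕ → Poly) → 1 ≤ n → PD.DS n (λ d → subst-pow (n /' d) (gaussSum b d)) ≈ b n
  möbius-inversion n b n≥1 = begin
    PD.DS n (λ d → subst-pow (n /' d) (gaussSum b d))
      ≈⟨ PD.Σ<-cong n (λ j _ → PD.guard-cong-if (suc j ∣? n) (λ j∣n →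
           gaussSum-subst-pow b (suc j) (n /' suc j) (quotient-pos j n n≥1 j∣n))) ⟩
    PD.DS n (λ d → PD.DS d (Ψ d))
      ≈⟨ PD.DS-nested n Ψ ⟩
    PD.DS n (λ f → PD.DS (n /' f) (λ e → Ψ (e * f) e))
      ≈⟨ PD.Σ<-cong n (λ l _ → PD.guard-cong-if (suc l ∣? n) (λ _ →
           PD.Σ<-cong (n /' suc l) (λ i _ → PD.guard-cong-if (suc i ∣? n /' suc l) (λ i∣n/l → regroup i l i∣n/l)))) ⟩
    PD.DS n (λ f → PD.DS (n /' f) (λ e → scale (ι (μ e)) (subst-pow (n /' f) (b f))))
      ≈⟨ PD.Σ<-cong n (λ l _ → PD.guard-cong (suc l ∣? n) (≈-sym (scale-Σ< (n /' suc l) (λ j → suc j ∣? n /' suc l) _ _))) ⟩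
    PD.DS n (λ f → scale (QD.DS (n /' f) (λ e → ι (μ e))) (subst-pow (n /' f) (b f)))
      ≈⟨ PD.Σ<-cong n (λ l _ → PD.guard-cong (suc l ∣? n) (≈-reflexive (cong (λ c → scale c (subst-pow (n /' suc l) (b (suc l))))
            (Eq.sym (ι-Σ< (n /' suc l) (λ j → suc j ∣? n /' suc l) (λ j → μ (suc j))))))) ⟩
    PD.DS n (λ f → μ-sum-term f)
      ≈⟨ PD.DS-split-top n μ-sum-term n≥1 ⟩
    PD.PDS n μ-sum-term ⊕ μ-sum-term n
      ≈⟨ ⊕-cong {PD.PDS n μ-sum-term} {[]} proper-terms-vanish top-term ⟩
    b n ∎
    where
    open import Relation.Binary.Reasoning.Setoid ≈-setoid
    Ψ : ℕ → ℕ → Poly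
    Ψ d e = scale (ι (μ e)) (subst-pow (e * (n /' d)) (b (d /' e)))
    μ-sum-term : ℕ → Poly
    μ-sum-term f = scale (ι (μ-sum (n /' f))) (subst-pow (n /' f) (b f))
    regroup : ∀ i l → suc i ∣ n /' suc l → Ψ (suc i * suc l) (suc i) ≈ scale (ι (μ (suc i))) (subst-pow (n /' suc l) (b (suc l)))
    regroup i l i∣n/l = ≈-reflexive (Eq.cong₂ (λ x y → scale (ι (μ (suc i))) (subst-pow x (b y)))
      (quotient-nested i l n i∣n/l) (Eq.trans (cong (_/ suc i) (ℕP.*-comm (suc i) (suc l))) (m*n/n≡m (suc l) (suc i))))
    proper-terms-vanish : PD.PDS n μ-sum-term ≈ []
    proper-terms-vanish = PD.Σ<-zero n (λ j _ → vanish ((suc j ∣? n) ×-dec ¬? (suc j ≟ n)))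
      where
      vanish : ∀ {j} (d : Dec (suc j ∣ n × suc j ≢ n)) → PD.guard d (μ-sum-term (suc j)) ≈ []
      vanish {j} (yes (j∣n , j≢n)) = ≈-trans
        (≈-reflexive (cong (λ c → scale (ι c) (subst-pow (n /' suc j) (b (suc j))))
                            (μ-sum-vanishes _ (quotient≥2 _ n n≥1 j∣n j≢n))))
        (scale-0 _)
      vanish (no _) = ≈-refl
    top-term : μ-sum-term n ≈ b n
    top-term = ≈-trans (≈-reflexive (cong (λ k → scale (ι (μ-sum k)) (subst-pow k (b n))) (n/'n≡1 n n≥1)))
               (≈-trans (scale-1 _) (subst-pow-1 (b n)))

module QIntegerIdentities where

  open import Data.Nat using (zero; suc; _+_; s≤s)
  import Data.Nat.Properties as ℕP
  open import Data.Rational using (0ℚ)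
  open import Data.List using ([]; _∷_; length; replicate)
  open import Data.List.Properties using (length-++; length-replicate)
  open import Relation.Binary.PropositionalEquality as Eq using (cong; subst; sym)

  open RationalPolynomials
  open SubstitutionAndEvaluation

  -- For d k = n, writing S = S(1) + (q - 1) T:
  --   (S [d]_q)(q^k) = S(1) [d]_{q^k} + [n]_q (q - 1) T(q^k),
  -- since [d]_{q^k} (q^k - 1) = [n]_q (q - 1).
  subst-pow-qint-⊗ : ∀ n d k S → 1 ≤ k → d * k ≡ n →
    subst-pow k (qint d ⊗ S) ≈ (scale (eval1 S) (subst-pow k (qint d)) ⊕ (qint n ⊗ (q-1 ⊗ subst-pow k (S ÷[q-1]))))
  subst-pow-qint-⊗ n d (suc k) S _ dk≡n = begin
    K.sp (qint d ⊗ S)                                   ≈⟨ K.sp-⊗ (qint d) S ⟩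
    [d]ₖ ⊗ K.sp S                                       ≈⟨ ⊗-congʳ [d]ₖ (K.sp-cong (≈-sym (factor-at-1 S))) ⟩
    [d]ₖ ⊗ K.sp ((q-1 ⊗ T) ⊕ (eval1 S ∷ []))             ≈⟨ ⊗-congʳ [d]ₖ (K.sp-⊕ (q-1 ⊗ T) (eval1 S ∷ [])) ⟩
    [d]ₖ ⊗ (K.sp (q-1 ⊗ T) ⊕ (eval1 S ∷ []))             ≈⟨ ⊗-distribˡ [d]ₖ (K.sp (q-1 ⊗ T)) (eval1 S ∷ []) ⟩
    ([d]ₖ ⊗ K.sp (q-1 ⊗ T)) ⊕ ([d]ₖ ⊗ (eval1 S ∷ []))    ≈⟨ ⊕-comm ([d]ₖ ⊗ K.sp (q-1 ⊗ T)) ([d]ₖ ⊗ (eval1 S ∷ [])) ⟩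
    ([d]ₖ ⊗ (eval1 S ∷ [])) ⊕ ([d]ₖ ⊗ K.sp (q-1 ⊗ T))    ≈⟨ ⊕-cong {[d]ₖ ⊗ (eval1 S ∷ [])} {scale (eval1 S) [d]ₖ} constant-part multiple-part ⟩
    scale (eval1 S) [d]ₖ ⊕ (qint n ⊗ (q-1 ⊗ K.sp T))     ∎
    where
    open import Relation.Binary.Reasoning.Setoid ≈-setoid
    module K = SubstPow k
    T = S ÷[q-1]
    [d]ₖ = K.sp (qint d)
    constant-part : ([d]ₖ ⊗ (eval1 S ∷ [])) ≈ scale (eval1 S) [d]ₖ
    constant-part = ≈-trans (⊗-comm [d]ₖ (eval1 S ∷ [])) (const-⊗ (eval1 S) [d]ₖ)
    multiple-part : ([d]ₖ ⊗ K.sp (q-1 ⊗ T)) ≈ (qint n ⊗ (q-1 ⊗ K.sp T))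
    multiple-part = begin
      [d]ₖ ⊗ K.sp (q-1 ⊗ T)           ≈⟨ ⊗-congʳ [d]ₖ (≈-trans (K.sp-⊗ q-1 T) (⊗-congˡ (K.sp T) (subst-pow-q-1 k))) ⟩
      [d]ₖ ⊗ (qᵈ-1 (suc k) ⊗ K.sp T)  ≈⟨ ⊗-assoc [d]ₖ (qᵈ-1 (suc k)) (K.sp T) ⟨
      ([d]ₖ ⊗ qᵈ-1 (suc k)) ⊗ K.sp T  ≈⟨ ⊗-congˡ (K.sp T) (qint-subst-pow d k) ⟩
      (qint (d * suc k) ⊗ q-1) ⊗ K.sp T ≈⟨ ⊗-assoc (qint (d * suc k)) q-1 (K.sp T) ⟩
      qint (d * suc k) ⊗ (q-1 ⊗ K.sp T) ≈⟨ ≈-reflexive (cong (λ x → qint x ⊗ (q-1 ⊗ K.sp T)) dk≡n) ⟩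
      qint n ⊗ (q-1 ⊗ K.sp T)           ∎

  coeff-beyond-length : ∀ p k → length p ≤ k → coeff p k ≡ 0ℚ
  coeff-beyond-length [] k _ = Eq.refl
  coeff-beyond-length (a ∷ p) (suc k) (s≤s l) = coeff-beyond-length p k l

  length-subst-pow-qint : ∀ f d → length (subst-pow (suc f) (qint (suc d))) ≡ suc (d * suc f)
  length-subst-pow-qint f zero = Eq.refl
  length-subst-pow-qint f (suc d) = cong suc (begin
    length (replicate f 0ℚ Data.List.++ subst-pow (suc f) (qint (suc d)))
      ≡⟨ length-++ (replicate f 0ℚ) ⟩
    length (replicate f 0ℚ) + length (subst-pow (suc f) (qint (suc d)))
      ≡⟨ Eq.cong₂ _+_ (length-replicate f) (length-subst-pow-qint f d) ⟩
    f + suc (d * suc f)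
      ≡⟨ ℕP.+-suc f (d * suc f) ⟩
    suc (f + d * suc f) ∎)
    where open Eq.≡-Reasoning

  subst-pow-qint-degree : ∀ d f j → suc d * suc (suc f) ∸ 1 ≤ j → coeff (subst-pow (suc (suc f)) (qint (suc d))) j ≡ 0ℚ
  subst-pow-qint-degree d f j h = coeff-beyond-length (subst-pow (suc (suc f)) (qint (suc d))) j
    (subst (_≤ j) (sym (length-subst-pow-qint (suc f) d)) (ℕP.≤-trans (s≤s (ℕP.m≤n+m (d * suc (suc f)) f)) h))

module Assembly (S : ℕ → Set) (a : ℕ → ℤP.Poly) (gauss : qGauss S a)
                (n m : ℕ) (n∈NS : InNS S n) (m≥1 : 1 ≤ m) where

  open import Data.Nat using (zero; suc; z≤n; s≤s; _≟_)
  open import Data.Nat.Divisibility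
  open import Data.Nat.DivMod using (_/_; m*[n/m]≡n)
  open import Data.Integer as ℤ using (+_)
  open import Data.Rational as ℚ using (ℚ)
  import Data.Rational.Properties as QP
  open import Data.List using ([]; _∷_)
  open import Relation.Nullary using (Dec; yes; no; ¬_)
  open import Relation.Nullary.Decidable using (_×-dec_; ¬?)
  open import Relation.Unary using (Decidable)
  open import Relation.Binary.PropositionalEquality as Eq using (cong)
  open import Data.Product using (proj₁; proj₂)
  open import Data.Empty using (⊥-elim)
  open import Function using (id)

  open Arithmetic
  open IntegerEmbedding
  open RationalPolynomials
  open SubstitutionAndEvaluation
  open IntegerToRational
  open PolynomialDivisorSums
  open QIntegerIdentities

  n≥1 : 1 ≤ n
  n≥1 = proj₁ n∈NS

  b : ℕ → Poly
  b d = toℚP (a (d * m))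

  g : ℕ → ℤ
  g d = ℤP.eval1 (a (d * m))

  divisor-in-NS : ∀ j → suc j ∣ n → InNS S (suc j)
  divisor-in-NS j j∣n = s≤s z≤n , λ p p-prime p∣j → proj₂ n∈NS p p-prime (∣-trans p∣j j∣n)

  gaussTermℤ : ℕ → ℕ → ℤP.Poly
  gaussTermℤ e f = ℤP.scale (μ e) (ℤP.subst-pow e (a (f * m)))

  gaussSum-toℚP : ∀ d → toℚP (ℤP.divSum d gaussTermℤ) ≈ gaussSum b d
  gaussSum-toℚP d = ≈-trans
    (≈-reflexive (Eq.trans (toℚP-divSum d gaussTermℤ) (divSum-cong d _ gaussTerm (λ e f →
      Eq.trans (toℚP-scale (μ e) _) (cong (scale (ι (μ e))) (toℚP-subst-pow e (a (f * m))))))))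
    (divSum-as-DS d gaussTerm)
    where
    gaussTerm : ℕ → ℕ → Poly
    gaussTerm e f = scale (ι (μ e)) (subst-pow e (b f))

  cofactorAt : ∀ j → Dec (suc j ∣ n) → Poly
  cofactorAt j (yes j∣n) = toℚP (proj₁ (gauss (suc j) m (divisor-in-NS j j∣n) m≥1))
  cofactorAt j (no _) = []

  cofactor : ℕ → Poly
  cofactor zero = []
  cofactor (suc j) = cofactorAt j (suc j ∣? n)

  gaussSum-factors : ∀ j → suc j ∣ n → gaussSum b (suc j) ≈ (qint (suc j) ⊗ cofactor (suc j))
  gaussSum-factors j j∣n with suc j ∣? n
  ... | no j∤n = ⊥-elim (j∤n j∣n)
  ... | yes j∣n′ = ≈-trans (≈-sym (gaussSum-toℚP (suc j))) (≈-trans (toℚP-≈ (proj₂ divisible))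
      (≈-reflexive (Eq.trans (toℚP-⊗ (ℤP.qint (suc j)) _) (cong (_⊗ toℚP (proj₁ divisible)) (toℚP-qint (suc j))))))
    where divisible = gauss (suc j) m (divisor-in-NS j j∣n′) m≥1

  numerator : ℕ → ℤ
  numerator d = divSumℤ d (λ e d/e → μ d/e ℤ.* g e)

  -- Evaluating C_d = [d]_q S_d at q = 1:  S_d(1) = numerator(d) / d.
  cofactor-at-1 : ∀ j → suc j ∣ n → eval1 (cofactor (suc j)) ≡ divℚ (numerator (suc j)) (suc j)
  cofactor-at-1 j j∣n = divℚ-unique (numerator d) j (eval1 (cofactor d)) (Eq.trans (Eq.sym C₁≡d·S₁) C₁≡numerator)
    where
    open Eq.≡-Reasoning
    d = suc j
    C₁≡d·S₁ : eval1 (gaussSum b d) ≡ ι (+ d) ℚ.* eval1 (cofactor d)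
    C₁≡d·S₁ = Eq.trans (eval-cong (gaussSum-factors j j∣n))
      (Eq.trans (eval-⊗ (qint d) (cofactor d)) (cong (ℚ._* eval1 (cofactor d)) (eval-qint d)))
    C₁≡numerator : eval1 (gaussSum b d) ≡ ι (numerator d)
    C₁≡numerator = begin
      eval1 (gaussSum b d)
        ≡⟨ eval-gaussSum b d ⟩
      QD.DS d (λ e → ι (μ e) ℚ.* eval1 (b (d /' e)))
        ≡⟨ QD.Σ<-cong d (λ i _ → QD.guard-cong (suc i ∣? d) (Eq.trans
             (cong (ι (μ (suc i)) ℚ.*_) (Eq.sym (toℚP-eval1 (a ((d /' suc i) * m))))) (Eq.sym (ι-* (μ (suc i)) (g (d /' suc i)))))) ⟩
      QD.DS d (λ e → ι (μ e ℤ.* g (d /' e)))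
        ≡⟨ ι-Σ< d (λ k → suc k ∣? d) (λ i → μ (suc i) ℤ.* g (d /' suc i)) ⟨
      ι (ZD.DS d (λ e → μ e ℤ.* g (d /' e)))
        ≡⟨ cong ι (ZD.DS-complement d (λ x y → μ x ℤ.* g y)) ⟩
      ι (ZD.DS d (λ e → μ (d /' e) ℤ.* g e))
        ≡⟨ cong ι (ZD.foldr-filter (λ k → suc k ∣? d) (λ k → μ (d / suc k) ℤ.* g (suc k)) id d) ⟨
      ι (numerator d) ∎

  U W : ℕ → Poly
  U d = scale (eval1 (cofactor d)) (subst-pow (n /' d) (qint d))
  W d = q-1 ⊗ subst-pow (n /' d) (cofactor d ÷[q-1])

  term-decomposition : ∀ j → suc j ∣ n → subst-pow (n /' suc j) (gaussSum b (suc j)) ≈ (U (suc j) ⊕ (qint n ⊗ W (suc j)))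
  term-decomposition j j∣n = ≈-trans (subst-pow-cong n/d≥1 (gaussSum-factors j j∣n))
    (subst-pow-qint-⊗ n (suc j) (n /' suc j) (cofactor (suc j)) n/d≥1 (m*[n/m]≡n j∣n))
    where n/d≥1 = quotient-pos j n n≥1 j∣n

  -- The term d = n is U_n = S_n(1) [n]_q, itself a multiple of [n]_q.
  U-top : U n ≈ (qint n ⊗ (eval1 (cofactor n) ∷ []))
  U-top = ≈-trans (≈-reflexive (cong (λ k → scale (eval1 (cofactor n)) (subst-pow k (qint n))) (n/'n≡1 n n≥1)))
          (≈-trans (scale-cong (eval1 (cofactor n)) (subst-pow-1 (qint n)))
          (≈-trans (≈-sym (const-⊗ (eval1 (cofactor n)) (qint n))) (⊗-comm (eval1 (cofactor n) ∷ []) (qint n))))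

  W-total : Poly
  W-total = (eval1 (cofactor n) ∷ []) ⊕ PD.DS n W

  decomposition : b n ≈ (PD.PDS n U ⊕ (qint n ⊗ W-total))
  decomposition = begin
    b n
      ≈⟨ möbius-inversion n b n≥1 ⟨
    PD.DS n (λ d → subst-pow (n /' d) (gaussSum b d))
      ≈⟨ PD.Σ<-cong n (λ j _ → PD.guard-cong-if (suc j ∣? n) (term-decomposition j)) ⟩
    PD.DS n (λ d → U d ⊕ (qint n ⊗ W d))
      ≈⟨ PD.Σ<-cong n (λ j _ → PD.guard-∙ (suc j ∣? n) (U (suc j)) (qint n ⊗ W (suc j))) ⟩
    PD.Σ< n (λ j → PD.guard (suc j ∣? n) (U (suc j)) ⊕ PD.guard (suc j ∣? n) (qint n ⊗ W (suc j)))
      ≈⟨ PD.Σ<-∙ n _ _ ⟩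
    PD.DS n U ⊕ PD.DS n (λ d → qint n ⊗ W d)
      ≈⟨ ⊕-cong {PD.DS n U} (PD.DS-split-top n U n≥1) (≈-sym [n]-⊗-DS) ⟩
    (PD.PDS n U ⊕ U n) ⊕ (qint n ⊗ PD.DS n W)
      ≈⟨ ⊕-assoc (PD.PDS n U) (U n) _ ⟩
    PD.PDS n U ⊕ (U n ⊕ (qint n ⊗ PD.DS n W))
      ≈⟨ ⊕-cong {PD.PDS n U} ≈-refl (≈-trans (⊕-cong U-top ≈-refl) (≈-sym (⊗-distribˡ (qint n) _ _))) ⟩
    PD.PDS n U ⊕ (qint n ⊗ W-total) ∎
    where
    open import Relation.Binary.Reasoning.Setoid ≈-setoid
    [n]-⊗-DS : (qint n ⊗ PD.DS n W) ≈ PD.DS n (λ d → qint n ⊗ W d)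
    [n]-⊗-DS = SumHomomorphism.Σ<-guard-hom ⊕-commutativeMonoid ⊕-commutativeMonoid
      (qint n ⊗_) (⊗-[] (qint n)) (⊗-distribˡ (qint n)) n (λ j → suc j ∣? n) (λ j → W (suc j))

  G-term : ℕ → Poly
  G-term d = scale (divℚ (numerator d) d) (subst-pow (n /' d) (qint d))

  proper? : Decidable (λ j → suc j ∣ n × ¬ suc j ≡ n)
  proper? j = (suc j ∣? n) ×-dec ¬? (suc j ≟ n)

  G-as-PDS : G n g ≈ PD.PDS n G-term
  G-as-PDS = PD.foldr-filter proper? (λ k → G-term (suc k)) id n

  PDS-U≈G : PD.PDS n U ≈ G n g
  PDS-U≈G = ≈-trans (PD.Σ<-cong n (λ j _ → PD.guard-cong-if (proper? j) (λ (j∣n , _) →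
      ≈-reflexive (cong (λ c → scale c (subst-pow (n /' suc j) (qint (suc j)))) (cofactor-at-1 j j∣n)))))
    (≈-sym G-as-PDS)

  G-degree : ∀ k → n ∸ 1 ≤ k → coeff (G n g) k ≡ ℚ.0ℚ
  G-degree k n∸1≤k = Eq.trans (get G-as-PDS k)
    (Eq.trans (SumHomomorphism.Σ<-guard-hom ⊕-commutativeMonoid QP.+-0-commutativeMonoid
                 (λ p → coeff p k) Eq.refl (λ x y → coeff-⊕ x y k) n proper? (λ j → G-term (suc j)))
      (QD.Σ<-zero n (λ j _ → term-vanishes j (proper? j))))
    where
    term-vanishes : ∀ j (d : Dec (suc j ∣ n × ¬ suc j ≡ n)) → QD.guard d (coeff (G-term (suc j)) k) ≡ ℚ.0ℚ
    term-vanishes j (no _) = Eq.refl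
    term-vanishes j (yes (j∣n , j≢n)) =
      Eq.trans (coeff-scale c (subst-pow (n /' suc j) (qint (suc j))) k)
        (Eq.trans (cong (c ℚ.*_) (beyond-degree (n /' suc j) (quotient≥2 j n n≥1 j∣n j≢n) (m*[n/m]≡n j∣n)))
        (QP.*-zeroʳ c))
      where
      c = divℚ (numerator (suc j)) (suc j)
      beyond-degree : ∀ f → 2 ≤ f → suc j * f ≡ n → coeff (subst-pow f (qint (suc j))) k ≡ ℚ.0ℚ
      beyond-degree (suc zero) (s≤s ()) _
      beyond-degree (suc (suc f)) _ jf≡n = subst-pow-qint-degree j f k (Eq.subst (λ x → x ∸ 1 ≤ k) (Eq.sym jf≡n) n∸1≤k)

proposition2p5 : (S : ℕ → Set) → IsSetOfPrimes S → (a : ℕ → ℤP.Poly) → qGauss S a →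
    (n m : ℕ) → InNS S n → 1 ≤ m →
    (ℚP.qint n ℚP.∣P (toℚP (a (n * m)) ℚP.⊖ G n (λ d → ℤP.eval1 (a (d * m)))))
    × (∀ k → n ∸ 1 ≤ k → ℚP.coeff (G n (λ d → ℤP.eval1 (a (d * m)))) k ≡ 0ℚ)
proposition2p5 S _ a gauss n m n∈NS m≥1 = divisibility , G-degree
  where
  open Assembly S a gauss n m n∈NS m≥1
  open RationalPolynomials using (get; ⊖-from-⊕; ≈-trans; ⊕-cong; ≈-refl)
  divisibility : ℚP.qint n ℚP.∣P (b n ℚP.⊖ G n g)
  divisibility = W-total , get (⊖-from-⊕ (b n) (G n g) (ℚP.qint n ℚP.⊗ W-total)
                                  (≈-trans decomposition (⊕-cong PDS-U≈G ≈-refl)))
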